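{- Let $\tau\in\mathcal{S}_k$ be a Hertzsprung pattern that is not self-overlapping. Then, as formal power series in $x$ with coefficients in $\mathbb{Z}[u]$, \[ \sum_{\pi\in\mathcal{S}}u^{\tau(\pi)}x^{|\pi|} = \sum_{m\geq 0} m!\,\bigl(x + (u-1)x^{|\tau|}\bigr)^m. \]
   Context: $\mathcal{S}_n$ is the set of permutations of $[n]$ in one-line notation ($\mathcal{S}_0$ contains the empty permutation), $\mathcal{S}=\bigcup_n\mathcal{S}_n$, and $|\pi|$ is the length of $\pi$. For $\tau\in\mathcal{S}_k$, an occurrence of the Hertzsprung pattern $\tau$ in a permutation $\pi$ is a factor (consecutive subword) $b_1\cdots b_k$ of $\pi$ with $b_1-\tau(1)=\cdots=b_k-\tau(k)$; $\tau(\pi)$ is the number of occurrences. $\tau$ is a Hertzsprung prefix (resp. suffix) of $\sigma$ if the first (resp. last) $k$ letters of $\sigma$ form an occurrence of $\tau$; it is proper if $|\sigma|>k$. $\tau$ is self-overlapping if there is a permutation $\sigma$ with $|\sigma|<2k$ such that $\tau$ is both a proper Hertzsprung prefix and a proper Hertzsprung suffix of $\sigma$. -}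

module Defs where

open import Data.Nat as ℕ using (ℕ; zero; suc; _≤_; _≤?_; _∸_; _!)
open import Data.Integer as ℤ using (ℤ; +_)
open import Data.Bool using (Bool; true; false; _∧_; T)
open import Data.List using (List; []; _∷_; length; take; drop; filter; map; concatMap; upTo)
open import Data.List.Relation.Unary.All using (All; all?)
open import Data.Product using (_×_; ∃; Σ; _,_)
open import Relation.Nullary using (¬_)
open import Relation.Nullary.Decidable using (⌊_⌋; _×-dec_)
open import Relation.Binary.PropositionalEquality using (_≡_)
import Data.List.Relation.Unary.Unique.DecPropositional as UP

open UP ℕ._≟_ using (Unique; unique?)

-- Permutations of [n] in one-line notation, as lists of naturals.

IsPerm : ℕ → List ℕ → Set
IsPerm n l = (length l ≡ n) × All (λ x → 1 ≤ x × x ≤ n) l × Unique l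

isPerm? : (n : ℕ) → (l : List ℕ) → Relation.Nullary.Dec (IsPerm n l)
isPerm? n l = (length l ℕ.≟ n) ×-dec (all? (λ x → (1 ≤? x) ×-dec (x ≤? n)) l ×-dec unique? l)

words : ℕ → ℕ → List (List ℕ)
words n zero = [] ∷ []
words n (suc k) = concatMap (λ a → map (a ∷_) (words n k)) (map suc (upTo n))

perms : ℕ → List (List ℕ)
perms n = filter (isPerm? n) (words n n)

shiftOK : ℤ → List ℕ → List ℕ → Bool
shiftOK c [] [] = true
shiftOK c (a ∷ as) (b ∷ bs) = ⌊ (+ b ℤ.- + a) ℤ.≟ c ⌋ ∧ shiftOK c as bs
shiftOK c _ _ = false

hz : List ℕ → List ℕ → Bool
hz [] [] = true
hz (a ∷ as) (b ∷ bs) = shiftOK (+ b ℤ.- + a) as bs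
hz _ _ = false

-- τ(π): number of factors of π (consecutive subwords, one per starting
-- position) that are occurrences of τ
occ : List ℕ → List ℕ → ℕ
occ τ [] = 0
occ τ (b ∷ π) with hz τ (take (length τ) (b ∷ π))
... | true  = suc (occ τ π)
... | false = occ τ π

HPrefix : List ℕ → List ℕ → Set
HPrefix τ σ = T (hz τ (take (length τ) σ))

HSuffix : List ℕ → List ℕ → Set
HSuffix τ σ = T (hz τ (drop (length σ ∸ length τ) σ))

SelfOverlapping : List ℕ → Set
SelfOverlapping τ =
  ∃ λ σ → IsPerm (length σ) σ × length τ ℕ.< length σ × length σ ℕ.< 2 ℕ.* length τ
        × HPrefix τ σ × HSuffix τ σ

-- Formal power series in x with coefficients in ℤ[u]:
-- F n j = coefficient of x^n u^j.

Series : Set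
Series = ℕ → ℕ → ℤ

sumTo : ℕ → (ℕ → ℤ) → ℤ
sumTo zero f = f 0
sumTo (suc n) f = sumTo n f ℤ.+ f (suc n)

sumBelow : ℕ → (ℕ → ℤ) → ℤ
sumBelow zero f = + 0
sumBelow (suc n) f = sumBelow n f ℤ.+ f n

δ : ℕ → ℕ → ℤ
δ a b = if⌊ a ℕ.≟ b ⌋
  where
  if⌊_⌋ : Relation.Nullary.Dec (a ≡ b) → ℤ
  if⌊ Relation.Nullary.yes _ ⌋ = + 1
  if⌊ Relation.Nullary.no _ ⌋ = + 0

constₛ : ℤ → Series
constₛ c n j = δ n 0 ℤ.* δ j 0 ℤ.* c

xₛ : Series
xₛ n j = δ n 1 ℤ.* δ j 0

uₛ : Series
uₛ n j = δ n 0 ℤ.* δ j 1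

_+ₛ_ : Series → Series → Series
(f +ₛ g) n j = f n j ℤ.+ g n j

_-ₛ_ : Series → Series → Series
(f -ₛ g) n j = f n j ℤ.- g n j

_*ₛ_ : Series → Series → Series
(f *ₛ g) n j = sumTo n (λ a → sumTo j (λ b → f a b ℤ.* g (n ∸ a) (j ∸ b)))

_^ₛ_ : Series → ℕ → Series
f ^ₛ zero = constₛ (+ 1)
f ^ₛ suc m = f *ₛ (f ^ₛ m)

_·ₛ_ : ℤ → Series → Series
(c ·ₛ f) n j = c ℤ.* f n j

infixl 6 _+ₛ_ _-ₛ_
infixl 7 _*ₛ_ _·ₛ_
infixr 8 _^ₛ_

-- Σ_{m≥0} T m = S as formal power series: every coefficient of the
-- partial sums Σ_{m<M} T m is eventually (for all large M) equal to
-- the corresponding coefficient of S (x-adic convergence).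
HasSum : (ℕ → Series) → Series → Set
HasSum T S = ∀ n j → ∃ λ N → ∀ M → N ≤ M → sumBelow M (λ m → T m n j) ≡ S n j

occGF : List ℕ → Series
occGF τ n j = + length (filter (λ π → occ τ π ℕ.≟ j) (perms n))

-- Cluster method: u^τ(π) = ∑_{S ⊆ occurrences of τ in π} (u - 1)^|S|, so the left-hand side
-- counts permutations with a set of marked occurrences, weighted by (u - 1)^(number marked).
-- Since τ is not self-overlapping, occurrences of τ in a permutation are disjoint, so a marked
-- permutation is just a sequence of pieces: single letters and marked blocks c + τ.  The values
-- of the pieces tile [n] by intervals, and removing the piece that contains the largest value
-- shows that the sequences of m pieces, weighted by x^n (u - 1)^(number of blocks), sum to
-- m! (x + (u - 1) x^k)^m.

module Submission where

open import Defs
open import Data.Bool using (true; false; T)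
open import Data.Empty using (⊥; ⊥-elim)
open import Data.Fin using (zero; suc)
import Data.Fin as Fin
import Data.Fin.Properties as Fin
open import Data.Integer as ℤ using (ℤ; +_; -[1+_])
import Data.Integer.Properties as ℤP
open import Data.Integer.Tactic.RingSolver using (solve-∀)
open import Algebra.Properties.CommutativeSemigroup ℤP.+-commutativeSemigroup
  using () renaming (interchange to +-interchange)
open import Data.Nat as ℕ using (ℕ; zero; suc; _≤_; _<_; _≤?_; _∸_; z≤n; s≤s; _!)
import Data.Nat.Properties as ℕP
import Data.Nat.Tactic.RingSolver as ℕS
open import Data.List
  using (List; []; _∷_; _++_; length; map; concatMap; applyUpTo; take; drop; insertAt; allFin; filter)
import Data.List.Properties as LP
open import Data.List.Membership.DecPropositional ℕ._≟_ using (_∈?_)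
open import Data.List.Membership.Propositional using (_∈_; _∉_; find; lose)
open import Data.List.Membership.Propositional.Properties
  using ( ∈-concatMap⁺; ∈-concatMap⁻; ∈-∃++; ∈-++⁻; ∈-++⁺ˡ; ∈-++⁺ʳ; ∈-applyUpTo⁺; ∈-map⁺; ∈-map⁻
        ; ∈-allFin; ∈-upTo⁺; ∈-filter⁺; ∈-filter⁻)
open import Data.List.Membership.Propositional.Properties.WithK using (unique∧set⇒bag)
open import Data.List.Relation.Binary.BagAndSetEquality using (∼bag⇒↭)
open import Data.List.Relation.Binary.Permutation.Propositional
  using (_↭_; prep; swap; ↭-sym; ↭⇒↭ₛ) renaming (refl to ↭-refl; trans to ↭-trans)
import Data.List.Relation.Binary.Permutation.Propositional.Properties as PermP
open import Relation.Binary.PropositionalEquality.Properties using (setoid)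
import Data.List.Relation.Binary.Permutation.Setoid.Properties (setoid ℕ) as PermₛP
open import Data.List.Relation.Binary.Pointwise using (Pointwise; []; _∷_)
open import Data.List.Relation.Binary.Subset.Propositional using (_⊆_)
open import Data.List.Relation.Unary.All as All using (All; []; _∷_)
import Data.List.Relation.Unary.All.Properties as AllP
open import Data.List.Relation.Unary.Any using (here; there)
open import Data.List.Relation.Unary.Unique.Propositional using (Unique; []; _∷_)
import Data.List.Relation.Unary.Unique.Propositional.Properties as UniqueP
import Data.Product
open import Data.Product using (_×_; _,_; ∃; proj₁; proj₂)
import Data.Sum
open import Data.Sum using (_⊎_; inj₁; inj₂)
open import Function using (_∘_; id)
open import Function.Bundles using (mk⇔)
open import Relation.Binary.Definitions using (tri<; tri≈; tri>)
open import Relation.Binary.PropositionalEquality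
open import Relation.Nullary using (Dec; yes; no; ¬_)

private variable
  A B : Set

when : {P : Set} → Dec P → ℤ → ℤ
when (yes _) z = z
when (no _)  _ = + 0

when-yes : ∀ {P : Set} (d : Dec P) → P → ∀ z → when d z ≡ z
when-yes (yes _) _ z = refl
when-yes (no ¬p) p _ = ⊥-elim (¬p p)

when-no : ∀ {P : Set} (d : Dec P) → ¬ P → ∀ z → when d z ≡ + 0
when-no (yes p) ¬p _ = ⊥-elim (¬p p)
when-no (no _)  _  _ = refl

when-*ˡ : ∀ {P : Set} (d : Dec P) c z → when d (c ℤ.* z) ≡ c ℤ.* when d z
when-*ˡ (yes _) c z = refl
when-*ˡ (no _)  c z = sym (ℤP.*-zeroʳ c)

when-difference : ∀ {P : Set} (d : Dec P) a b → when d a ℤ.- when d b ≡ when d (a ℤ.- b)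
when-difference (yes _) a b = refl
when-difference (no _)  a b = refl

δ-refl : ∀ a → δ a a ≡ + 1
δ-refl a with a ℕ.≟ a
... | yes _ = refl
... | no a≢a = ⊥-elim (a≢a refl)

δ-≢ : ∀ {a b} → a ≢ b → δ a b ≡ + 0
δ-≢ {a} {b} a≢b with a ℕ.≟ b
... | yes a≡b = ⊥-elim (a≢b a≡b)
... | no _ = refl

δ-suc : ∀ a b → δ (suc a) (suc b) ≡ δ a b
δ-suc a b with a ℕ.≟ b
... | yes refl = δ-refl (suc a)
... | no a≢b = δ-≢ (a≢b ∘ ℕP.suc-injective)

δ-sym : ∀ a b → δ a b ≡ δ b a
δ-sym a b with a ℕ.≟ b
... | yes refl = sym (δ-refl a)
... | no a≢b = sym (δ-≢ (a≢b ∘ sym))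

δ-∸ : ∀ {p n} p' → p ≤ n → δ (n ∸ p) p' ≡ δ n (p ℕ.+ p')
δ-∸ p' z≤n = refl
δ-∸ {suc p} {suc n} p' (s≤s p≤n) = trans (δ-∸ p' p≤n) (sym (δ-suc n (p ℕ.+ p')))

when-δ-∸ : ∀ p n p' z → when (p ≤? n) (δ (n ∸ p) p' ℤ.* z) ≡ δ n (p ℕ.+ p') ℤ.* z
when-δ-∸ p n p' z with p ≤? n
... | yes p≤n = cong (ℤ._* z) (δ-∸ p' p≤n)
... | no p≰n = sym (cong (ℤ._* z) (δ-≢ n≢p+p'))
  where n≢p+p' : n ≢ p ℕ.+ p'
        n≢p+p' refl = p≰n (ℕP.m≤m+n p p')

when-δ-pred : ∀ o j → when (1 ≤? j) (δ o (j ∸ 1)) ≡ δ (suc o) j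
when-δ-pred o zero    = sym (δ-≢ {suc o} {0} λ ())
when-δ-pred o (suc j) = sym (δ-suc o j)

+suc*δ-suc : ∀ l m z → + suc l ℤ.* (δ (suc l) (suc m) ℤ.* z) ≡ + suc m ℤ.* (δ l m ℤ.* z)
+suc*δ-suc l m z = trans (cong (λ d → + suc l ℤ.* (d ℤ.* z)) (δ-suc l m)) (by-cases (l ℕ.≟ m))
  where
  by-cases : Dec (l ≡ m) → + suc l ℤ.* (δ l m ℤ.* z) ≡ + suc m ℤ.* (δ l m ℤ.* z)
  by-cases (yes refl) = refl
  by-cases (no l≢m) rewrite δ-≢ l≢m = trans (ℤP.*-zeroʳ (+ suc l)) (sym (ℤP.*-zeroʳ (+ suc m)))

sumTo-cong : ∀ n {f g : ℕ → ℤ} → (∀ a → f a ≡ g a) → sumTo n f ≡ sumTo n g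
sumTo-cong zero    f≗g = f≗g 0
sumTo-cong (suc n) f≗g = cong₂ ℤ._+_ (sumTo-cong n f≗g) (f≗g (suc n))

sumTo-+ : ∀ n (f g : ℕ → ℤ) → sumTo n (λ a → f a ℤ.+ g a) ≡ sumTo n f ℤ.+ sumTo n g
sumTo-+ zero    f g = refl
sumTo-+ (suc n) f g rewrite sumTo-+ n f g = +-interchange (sumTo n f) (sumTo n g) _ _

sumTo-δ : ∀ n p (g : ℕ → ℤ) → sumTo n (λ a → δ a p ℤ.* g a) ≡ when (p ≤? n) (g p)
sumTo-δ zero zero    g rewrite δ-refl 0 = ℤP.*-identityˡ (g 0)
sumTo-δ zero (suc p) g = refl
sumTo-δ (suc n) p g with ℕP.<-cmp p (suc n)
... | tri< (s≤s p≤n) p≢1+n _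
  rewrite sumTo-δ n p g | δ-≢ (p≢1+n ∘ sym)
        | when-yes (p ≤? n) p≤n (g p) | when-yes (p ≤? suc n) (ℕP.m≤n⇒m≤1+n p≤n) (g p)
  = ℤP.+-identityʳ (g p)
... | tri≈ _ refl _
  rewrite sumTo-δ n (suc n) g | δ-refl (suc n)
        | when-no (suc n ≤? n) (ℕP.<⇒≱ ℕP.≤-refl) (g (suc n))
        | when-yes (suc n ≤? suc n) ℕP.≤-refl (g (suc n))
  = trans (ℤP.+-identityˡ _) (ℤP.*-identityˡ (g (suc n)))
... | tri> _ p≢1+n 1+n<p
  rewrite sumTo-δ n p g | δ-≢ (p≢1+n ∘ sym)
        | when-no (p ≤? n) (ℕP.<⇒≱ (ℕP.<-trans ℕP.≤-refl 1+n<p)) (g p)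
        | when-no (p ≤? suc n) (ℕP.<⇒≱ 1+n<p) (g p)
  = refl

-- Formal power series

_≈ₛ_ : Series → Series → Set
f ≈ₛ g = ∀ n j → f n j ≡ g n j

infix 4 _≈ₛ_

monomial : ℕ → ℕ → ℤ → Series
monomial p q c a b = δ a p ℤ.* (δ b q ℤ.* c)

shift : ℕ → ℕ → Series → Series
shift p q F n j = when (p ≤? n) (when (q ≤? j) (F (n ∸ p) (j ∸ q)))

*ₛ-congˡ : ∀ {f g} h → f ≈ₛ g → f *ₛ h ≈ₛ g *ₛ h
*ₛ-congˡ h f≈g n j = sumTo-cong n λ a → sumTo-cong j λ b → cong (ℤ._* h (n ∸ a) (j ∸ b)) (f≈g a b)

*ₛ-congʳ : ∀ f {g h} → g ≈ₛ h → f *ₛ g ≈ₛ f *ₛ h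
*ₛ-congʳ f g≈h n j = sumTo-cong n λ a → sumTo-cong j λ b → cong (f a b ℤ.*_) (g≈h (n ∸ a) (j ∸ b))

*ₛ-distribʳ-+ₛ : ∀ f g h → (f +ₛ g) *ₛ h ≈ₛ f *ₛ h +ₛ g *ₛ h
*ₛ-distribʳ-+ₛ f g h n j = begin
  sumTo n (λ a → sumTo j λ b → (f a b ℤ.+ g a b) ℤ.* h (n ∸ a) (j ∸ b))
    ≡⟨ sumTo-cong n (λ a → trans (sumTo-cong j λ b → ℤP.*-distribʳ-+ (h (n ∸ a) (j ∸ b)) (f a b) (g a b))
                                 (sumTo-+ j _ _)) ⟩
  sumTo n (λ a → sumTo j (λ b → f a b ℤ.* h (n ∸ a) (j ∸ b)) ℤ.+ sumTo j (λ b → g a b ℤ.* h (n ∸ a) (j ∸ b)))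
    ≡⟨ sumTo-+ n _ _ ⟩
  (f *ₛ h +ₛ g *ₛ h) n j ∎
  where open ≡-Reasoning

monomial-*ₛ : ∀ p q c F → monomial p q c *ₛ F ≈ₛ c ·ₛ shift p q F
monomial-*ₛ p q c F n j = begin
  sumTo n (λ a → sumTo j λ b → δ a p ℤ.* (δ b q ℤ.* c) ℤ.* F (n ∸ a) (j ∸ b))
    ≡⟨ sumTo-cong n (λ a → sumTo-cong j λ b → reorder (δ a p) (δ b q) c (F (n ∸ a) (j ∸ b))) ⟩
  sumTo n (λ a → sumTo j λ b → δ b q ℤ.* (δ a p ℤ.* (c ℤ.* F (n ∸ a) (j ∸ b))))
    ≡⟨ sumTo-cong n (λ a → trans (sumTo-δ j q _) (when-*ˡ (q ≤? j) (δ a p) _)) ⟩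
  sumTo n (λ a → δ a p ℤ.* when (q ≤? j) (c ℤ.* F (n ∸ a) (j ∸ q)))
    ≡⟨ sumTo-δ n p _ ⟩
  when (p ≤? n) (when (q ≤? j) (c ℤ.* F (n ∸ p) (j ∸ q)))
    ≡⟨ trans (cong (when (p ≤? n)) (when-*ˡ (q ≤? j) c _)) (when-*ˡ (p ≤? n) c _) ⟩
  (c ·ₛ shift p q F) n j ∎
  where
  open ≡-Reasoning
  reorder : ∀ x y z w → x ℤ.* (y ℤ.* z) ℤ.* w ≡ y ℤ.* (x ℤ.* (z ℤ.* w))
  reorder = solve-∀

monomial-*ₛ-monomial : ∀ p q c p' q' c' →
  monomial p q c *ₛ monomial p' q' c' ≈ₛ monomial (p ℕ.+ p') (q ℕ.+ q') (c ℤ.* c')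
monomial-*ₛ-monomial p q c p' q' c' n j = begin
  (monomial p q c *ₛ monomial p' q' c') n j
    ≡⟨ monomial-*ₛ p q c (monomial p' q' c') n j ⟩
  c ℤ.* when (p ≤? n) (when (q ≤? j) (δ (n ∸ p) p' ℤ.* (δ (j ∸ q) q' ℤ.* c')))
    ≡⟨ cong (λ z → c ℤ.* when (p ≤? n) z)
            (trans (when-*ˡ (q ≤? j) (δ (n ∸ p) p') _) (cong (δ (n ∸ p) p' ℤ.*_) (when-δ-∸ q j q' c'))) ⟩
  c ℤ.* when (p ≤? n) (δ (n ∸ p) p' ℤ.* (δ j (q ℕ.+ q') ℤ.* c'))
    ≡⟨ cong (c ℤ.*_) (when-δ-∸ p n p' _) ⟩
  c ℤ.* (δ n (p ℕ.+ p') ℤ.* (δ j (q ℕ.+ q') ℤ.* c'))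
    ≡⟨ reorder c (δ n (p ℕ.+ p')) (δ j (q ℕ.+ q')) c' ⟩
  monomial (p ℕ.+ p') (q ℕ.+ q') (c ℤ.* c') n j ∎
  where
  open ≡-Reasoning
  reorder : ∀ x y z w → x ℤ.* (y ℤ.* (z ℤ.* w)) ≡ y ℤ.* (z ℤ.* (x ℤ.* w))
  reorder = solve-∀

xₛ≈monomial : xₛ ≈ₛ monomial 1 0 (+ 1)
xₛ≈monomial n j = cong (δ n 1 ℤ.*_) (sym (ℤP.*-identityʳ (δ j 0)))

xₛ^ₛ≈monomial : ∀ s → xₛ ^ₛ s ≈ₛ monomial s 0 (+ 1)
xₛ^ₛ≈monomial zero    n j = ℤP.*-assoc (δ n 0) (δ j 0) (+ 1)
xₛ^ₛ≈monomial (suc s) n j = begin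
  (xₛ *ₛ xₛ ^ₛ s) n j                       ≡⟨ *ₛ-congˡ (xₛ ^ₛ s) xₛ≈monomial n j ⟩
  (monomial 1 0 (+ 1) *ₛ xₛ ^ₛ s) n j         ≡⟨ *ₛ-congʳ (monomial 1 0 (+ 1)) (xₛ^ₛ≈monomial s) n j ⟩
  (monomial 1 0 (+ 1) *ₛ monomial s 0 (+ 1)) n j ≡⟨ monomial-*ₛ-monomial 1 0 (+ 1) s 0 (+ 1) n j ⟩
  monomial (suc s) 0 (+ 1) n j ∎
  where open ≡-Reasoning

uₛ-1≈monomials : uₛ -ₛ constₛ (+ 1) ≈ₛ monomial 0 1 (+ 1) +ₛ monomial 0 0 -[1+ 0 ]
uₛ-1≈monomials n j = expand (δ n 0) (δ j 1) (δ j 0)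
  where expand : ∀ x y z → x ℤ.* y ℤ.- x ℤ.* z ℤ.* + 1 ≡ x ℤ.* (y ℤ.* + 1) ℤ.+ x ℤ.* (z ℤ.* -[1+ 0 ])
        expand = solve-∀

cluster : ℕ → Series
cluster k = xₛ +ₛ (uₛ -ₛ constₛ (+ 1)) *ₛ xₛ ^ₛ k

cluster≈monomials : ∀ k → cluster k ≈ₛ monomial 1 0 (+ 1) +ₛ (monomial k 1 (+ 1) +ₛ monomial k 0 -[1+ 0 ])
cluster≈monomials k n j = cong₂ ℤ._+_ (xₛ≈monomial n j) (begin
  ((uₛ -ₛ constₛ (+ 1)) *ₛ xₛ ^ₛ k) n j
    ≡⟨ *ₛ-congˡ (xₛ ^ₛ k) uₛ-1≈monomials n j ⟩
  ((monomial 0 1 (+ 1) +ₛ monomial 0 0 -[1+ 0 ]) *ₛ xₛ ^ₛ k) n j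
    ≡⟨ *ₛ-distribʳ-+ₛ (monomial 0 1 (+ 1)) (monomial 0 0 -[1+ 0 ]) (xₛ ^ₛ k) n j ⟩
  (monomial 0 1 (+ 1) *ₛ xₛ ^ₛ k) n j ℤ.+ (monomial 0 0 -[1+ 0 ] *ₛ xₛ ^ₛ k) n j
    ≡⟨ cong₂ ℤ._+_ (trans (*ₛ-congʳ (monomial 0 1 (+ 1)) (xₛ^ₛ≈monomial k) n j)
                          (monomial-*ₛ-monomial 0 1 (+ 1) k 0 (+ 1) n j))
                   (trans (*ₛ-congʳ (monomial 0 0 -[1+ 0 ]) (xₛ^ₛ≈monomial k) n j)
                          (monomial-*ₛ-monomial 0 0 -[1+ 0 ] k 0 (+ 1) n j)) ⟩
  monomial k 1 (+ 1) n j ℤ.+ monomial k 0 -[1+ 0 ] n j ∎)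
  where open ≡-Reasoning

mulCluster : ℕ → Series → Series
mulCluster k F = shift 1 0 F +ₛ (shift k 1 F -ₛ shift k 0 F)

cluster-*ₛ : ∀ k F → cluster k *ₛ F ≈ₛ mulCluster k F
cluster-*ₛ k F n j = begin
  (cluster k *ₛ F) n j
    ≡⟨ *ₛ-congˡ F (cluster≈monomials k) n j ⟩
  ((M₁ +ₛ (M₂ +ₛ M₃)) *ₛ F) n j
    ≡⟨ *ₛ-distribʳ-+ₛ M₁ (M₂ +ₛ M₃) F n j ⟩
  (M₁ *ₛ F) n j ℤ.+ ((M₂ +ₛ M₃) *ₛ F) n j
    ≡⟨ cong (λ z → (M₁ *ₛ F) n j ℤ.+ z) (*ₛ-distribʳ-+ₛ M₂ M₃ F n j) ⟩
  (M₁ *ₛ F) n j ℤ.+ ((M₂ *ₛ F) n j ℤ.+ (M₃ *ₛ F) n j)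
    ≡⟨ cong₂ ℤ._+_ (monomial-*ₛ 1 0 (+ 1) F n j)
                   (cong₂ ℤ._+_ (monomial-*ₛ k 1 (+ 1) F n j) (monomial-*ₛ k 0 -[1+ 0 ] F n j)) ⟩
  + 1 ℤ.* shift 1 0 F n j ℤ.+ (+ 1 ℤ.* shift k 1 F n j ℤ.+ -[1+ 0 ] ℤ.* shift k 0 F n j)
    ≡⟨ simplify (shift 1 0 F n j) (shift k 1 F n j) (shift k 0 F n j) ⟩
  mulCluster k F n j ∎
  where
  open ≡-Reasoning
  M₁ M₂ M₃ : Series
  M₁ = monomial 1 0 (+ 1)
  M₂ = monomial k 1 (+ 1)
  M₃ = monomial k 0 -[1+ 0 ]
  simplify : ∀ x y z → + 1 ℤ.* x ℤ.+ (+ 1 ℤ.* y ℤ.+ -[1+ 0 ] ℤ.* z) ≡ x ℤ.+ (y ℤ.- z)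
  simplify = solve-∀

shift-cong : ∀ p q {F G} → F ≈ₛ G → shift p q F ≈ₛ shift p q G
shift-cong p q F≈G n j = cong (when (p ≤? n)) (cong (when (q ≤? j)) (F≈G (n ∸ p) (j ∸ q)))

shift-·ₛ : ∀ p q c F → c ·ₛ shift p q F ≈ₛ shift p q (c ·ₛ F)
shift-·ₛ p q c F n j =
  sym (trans (cong (when (p ≤? n)) (when-*ˡ (q ≤? j) c _)) (when-*ˡ (p ≤? n) c _))

mulCluster-cong : ∀ k {F G} → F ≈ₛ G → mulCluster k F ≈ₛ mulCluster k G
mulCluster-cong k F≈G n j =
  cong₂ ℤ._+_ (shift-cong 1 0 F≈G n j) (cong₂ ℤ._-_ (shift-cong k 1 F≈G n j) (shift-cong k 0 F≈G n j))

mulCluster-·ₛ : ∀ k c F → c ·ₛ mulCluster k F ≈ₛ mulCluster k (c ·ₛ F)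
mulCluster-·ₛ k c F n j = begin
  c ℤ.* (shift 1 0 F n j ℤ.+ (shift k 1 F n j ℤ.- shift k 0 F n j))
    ≡⟨ distrib c _ _ _ ⟩
  c ℤ.* shift 1 0 F n j ℤ.+ (c ℤ.* shift k 1 F n j ℤ.- c ℤ.* shift k 0 F n j)
    ≡⟨ cong₂ ℤ._+_ (shift-·ₛ 1 0 c F n j) (cong₂ ℤ._-_ (shift-·ₛ k 1 c F n j) (shift-·ₛ k 0 c F n j)) ⟩
  mulCluster k (c ·ₛ F) n j ∎
  where
  open ≡-Reasoning
  distrib : ∀ c x y z → c ℤ.* (x ℤ.+ (y ℤ.- z)) ≡ c ℤ.* x ℤ.+ (c ℤ.* y ℤ.- c ℤ.* z)
  distrib = solve-∀

factorial-·ₛ-cluster^ₛ : ∀ k (D : ℕ → Series) → D 0 ≈ₛ constₛ (+ 1)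
  → (∀ m → D (suc m) ≈ₛ + suc m ·ₛ mulCluster k (D m))
  → ∀ m → + (m !) ·ₛ cluster k ^ₛ m ≈ₛ D m
factorial-·ₛ-cluster^ₛ k D D₀ Dₛ zero n j = trans (ℤP.*-identityˡ _) (sym (D₀ n j))
factorial-·ₛ-cluster^ₛ k D D₀ Dₛ (suc m) n j = begin
  + (suc m ℕ.* m !) ℤ.* (cluster k *ₛ cluster k ^ₛ m) n j
    ≡⟨ cong₂ ℤ._*_ (ℤP.pos-* (suc m) (m !)) (cluster-*ₛ k (cluster k ^ₛ m) n j) ⟩
  + suc m ℤ.* + (m !) ℤ.* mulCluster k (cluster k ^ₛ m) n j
    ≡⟨ ℤP.*-assoc (+ suc m) (+ (m !)) _ ⟩
  + suc m ℤ.* (+ (m !) ℤ.* mulCluster k (cluster k ^ₛ m) n j)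
    ≡⟨ cong (+ suc m ℤ.*_) (mulCluster-·ₛ k (+ (m !)) (cluster k ^ₛ m) n j) ⟩
  + suc m ℤ.* mulCluster k (+ (m !) ·ₛ cluster k ^ₛ m) n j
    ≡⟨ cong (+ suc m ℤ.*_) (mulCluster-cong k (factorial-·ₛ-cluster^ₛ k D D₀ Dₛ m) n j) ⟩
  + suc m ℤ.* mulCluster k (D m) n j
    ≡⟨ sym (Dₛ m n j) ⟩
  D (suc m) n j ∎
  where open ≡-Reasoning

-- Lists

take-++ : ∀ {n} (xs ys : List A) → length xs ≡ n → take n (xs ++ ys) ≡ xs
take-++ []       ys refl = refl
take-++ (x ∷ xs) ys refl = cong (x ∷_) (take-++ xs ys refl)

drop-++ : ∀ {n} (xs ys : List A) → length xs ≡ n → drop n (xs ++ ys) ≡ ys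
drop-++ []       ys refl = refl
drop-++ (x ∷ xs) ys refl = drop-++ xs ys refl

take-++-≥ : ∀ {n} (xs ys : List A) → length xs ≤ n → take n (xs ++ ys) ≡ xs ++ take (n ∸ length xs) ys
take-++-≥             []       ys _           = refl
take-++-≥ {n = suc n} (x ∷ xs) ys (s≤s len≤n) = cong (x ∷_) (take-++-≥ xs ys len≤n)

take-+ : ∀ m n (xs : List A) → take (m ℕ.+ n) xs ≡ take m xs ++ take n (drop m xs)
take-+ zero    n xs       = refl
take-+ (suc m) n []       = sym (LP.take-[] n)
take-+ (suc m) n (x ∷ xs) = cong (x ∷_) (take-+ m n xs)

∈-take : ∀ n {xs : List A} {y} → y ∈ take n xs → y ∈ xs
∈-take n {xs} y∈ = subst (_ ∈_) (LP.take++drop≡id n xs) (∈-++⁺ˡ y∈)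

map-∸-shift : ∀ {lo c} xs → lo ≤ c → map (_∸ lo) (map (c ℕ.+_) xs) ≡ map ((c ∸ lo) ℕ.+_) xs
map-∸-shift xs lo≤c = trans (sym (LP.map-∘ xs)) (LP.map-cong (λ t → ℕP.+-∸-comm t lo≤c) xs)

∈-concatMap-intro : ∀ (f : A → List B) {x xs y} → x ∈ xs → y ∈ f x → y ∈ concatMap f xs
∈-concatMap-intro f x∈xs y∈fx = ∈-concatMap⁺ f (lose x∈xs y∈fx)

Unique-concatMap : ∀ (f : A → List B) {xs} → Unique xs → (∀ {x} → x ∈ xs → Unique (f x))
  → (∀ {x y z} → x ∈ xs → y ∈ xs → z ∈ f x → z ∈ f y → x ≡ y) → Unique (concatMap f xs)
Unique-concatMap f {[]}     _            _      _     = []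
Unique-concatMap f {x ∷ xs} (x∉xs ∷ u-xs) u-f f-disj =
  UniqueP.++⁺ (u-f (here refl)) (Unique-concatMap f u-xs (u-f ∘ there) λ p q → f-disj (there p) (there q))
    λ (z∈fx , z∈rest) → let (y , y∈xs , z∈fy) = find (∈-concatMap⁻ f z∈rest)
                        in All.lookup x∉xs y∈xs (f-disj (here refl) (there y∈xs) z∈fx z∈fy)

Unique-map⁺-on : ∀ (f : A → B) {xs} → (∀ {x y} → x ∈ xs → y ∈ xs → f x ≡ f y → x ≡ y)
  → Unique xs → Unique (map f xs)
Unique-map⁺-on f {[]}     _   []            = []
Unique-map⁺-on f {x ∷ xs} inj (x∉xs ∷ u-xs) =
  AllP.map⁺ (All.tabulate λ y∈xs fx≡fy → All.lookup x∉xs y∈xs (inj (here refl) (there y∈xs) fx≡fy))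
  ∷ Unique-map⁺-on f (λ p q → inj (there p) (there q)) u-xs

Unique-++⁻ʳ : ∀ (xs : List A) {ys} → Unique (xs ++ ys) → Unique ys
Unique-++⁻ʳ []       u-ys        = u-ys
Unique-++⁻ʳ (x ∷ xs) (_ ∷ u-rest) = Unique-++⁻ʳ xs u-rest

Unique-++⁻-disjoint : ∀ (xs : List A) {ys v} → Unique (xs ++ ys) → v ∈ xs → v ∉ ys
Unique-++⁻-disjoint (x ∷ xs) (x∉rest ∷ _) (here refl) v∈ys = All.lookup x∉rest (∈-++⁺ʳ xs v∈ys) refl
Unique-++⁻-disjoint (x ∷ xs) (_ ∷ u-rest) (there v∈xs) v∈ys = Unique-++⁻-disjoint xs u-rest v∈xs v∈ys

Unique-⊆⇒length≤ : ∀ {xs ys : List A} → Unique xs → xs ⊆ ys → length xs ≤ length ys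
Unique-⊆⇒length≤ {xs = []}     _             _  = z≤n
Unique-⊆⇒length≤ {xs = x ∷ xs} (x∉xs ∷ u-xs) xs⊆ys with ∈-∃++ (xs⊆ys (here refl))
... | P , C , refl = begin
  suc (length xs)       ≤⟨ s≤s (Unique-⊆⇒length≤ u-xs xs⊆P++C) ⟩
  suc (length (P ++ C)) ≡⟨ sym (length-++-∷ P C) ⟩
  length (P ++ x ∷ C)   ∎
  where
  open ℕP.≤-Reasoning
  xs⊆P++C : xs ⊆ P ++ C
  xs⊆P++C {z} z∈xs with ∈-++⁻ P (xs⊆ys (there z∈xs))
  ... | inj₁ z∈P         = ∈-++⁺ˡ z∈P
  ... | inj₂ (here z≡x)  = ⊥-elim (All.lookup x∉xs z∈xs (sym z≡x))
  ... | inj₂ (there z∈C) = ∈-++⁺ʳ P z∈C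
  length-++-∷ : ∀ P C → length (P ++ x ∷ C) ≡ suc (length (P ++ C))
  length-++-∷ []      C = refl
  length-++-∷ (_ ∷ P) C = cong suc (length-++-∷ P C)

length≤interval : ∀ {lo hi ys} → Unique ys → All (λ y → lo < y × y ≤ hi) ys → length ys ≤ hi ∸ lo
length≤interval {lo} {hi} {ys} u-ys bounds = begin
  length ys                          ≤⟨ Unique-⊆⇒length≤ u-ys ys⊆interval ⟩
  length (applyUpTo (suc lo ℕ.+_) (hi ∸ lo)) ≡⟨ LP.length-applyUpTo _ (hi ∸ lo) ⟩
  hi ∸ lo                            ∎
  where
  open ℕP.≤-Reasoning
  ys⊆interval : ys ⊆ applyUpTo (suc lo ℕ.+_) (hi ∸ lo)
  ys⊆interval y∈ys with All.lookup bounds y∈ys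
  ... | lo<y , y≤hi = subst (_∈ _) (ℕP.m+[n∸m]≡n lo<y) (∈-applyUpTo⁺ (suc lo ℕ.+_) (ℕP.∸-monoˡ-< (s≤s y≤hi) lo<y))

onlyIf : {P : Set} → Dec P → List A → List A
onlyIf (yes _) xs = xs
onlyIf (no _)  _  = []

∈-onlyIf⁺ : ∀ {P : Set} (d : Dec P) {x : A} {xs} → P → x ∈ xs → x ∈ onlyIf d xs
∈-onlyIf⁺ (yes _) _ x∈xs = x∈xs
∈-onlyIf⁺ (no ¬p) p _    = ⊥-elim (¬p p)

∈-onlyIf⁻ : ∀ {P : Set} (d : Dec P) {x : A} {xs} → x ∈ onlyIf d xs → P × x ∈ xs
∈-onlyIf⁻ (yes p) x∈xs = p , x∈xs

Unique-onlyIf : ∀ {P : Set} (d : Dec P) {xs : List A} → Unique xs → Unique (onlyIf d xs)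
Unique-onlyIf (yes _) u = u
Unique-onlyIf (no _)  _ = []

insertAt-injective : ∀ {x : A} {xs ys i j} → x ∉ xs → x ∉ ys → insertAt xs i x ≡ insertAt ys j x
  → xs ≡ ys × Fin.toℕ i ≡ Fin.toℕ j
insertAt-injective {i = zero} {zero} _ _ refl = refl , refl
insertAt-injective {ys = _ ∷ _} {zero}  {suc _} _ x∉ys refl = ⊥-elim (x∉ys (here refl))
insertAt-injective {xs = _ ∷ _} {i = suc _} {zero} x∉xs _ refl = ⊥-elim (x∉xs (here refl))
insertAt-injective {xs = _ ∷ _} {_ ∷ _} {suc _} {suc _} x∉xs x∉ys eq with LP.∷-injective eq
... | refl , eq′ with insertAt-injective (x∉xs ∘ there) (x∉ys ∘ there) eq′
...   | refl , i≡j = refl , cong suc i≡j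

x∈insertAt : ∀ (xs : List A) i x → x ∈ insertAt xs i x
x∈insertAt xs       zero    x = here refl
x∈insertAt (_ ∷ xs) (suc i) x = there (x∈insertAt xs i x)

∈-insertAt⁻ : ∀ (xs : List A) i {x y} → y ∈ insertAt xs i x → y ≡ x ⊎ y ∈ xs
∈-insertAt⁻ xs       zero    (here y≡x)  = inj₁ y≡x
∈-insertAt⁻ xs       zero    (there y∈)  = inj₂ y∈
∈-insertAt⁻ (_ ∷ xs) (suc i) (here y≡x′) = inj₂ (here y≡x′)
∈-insertAt⁻ (_ ∷ xs) (suc i) (there y∈)  = Data.Sum.map₂ there (∈-insertAt⁻ xs i y∈)

insertions : A → List A → List (List A)
insertions x xs = map (λ i → insertAt xs i x) (allFin (suc (length xs)))

length-insertions : ∀ (x : A) xs → length (insertions x xs) ≡ suc (length xs)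
length-insertions x xs = trans (LP.length-map (λ i → insertAt xs i x) (allFin (suc (length xs)))) (LP.length-tabulate id)

∈-insertions⁻ : ∀ {x : A} {xs ys} → ys ∈ insertions x xs → ∃ λ i → ys ≡ insertAt xs i x
∈-insertions⁻ {x = x} {xs} ys∈ =
  Data.Product.map id proj₂ (∈-map⁻ (λ i → insertAt xs i x) {xs = allFin (suc (length xs))} ys∈)

insertAt-++ : ∀ (x : A) P C → ∃ λ i → insertAt (P ++ C) i x ≡ P ++ x ∷ C
insertAt-++ x []      C = zero , refl
insertAt-++ x (y ∷ P) C = Data.Product.map suc (cong (y ∷_)) (insertAt-++ x P C)

∈-insertions⁺ : ∀ (x : A) P C → P ++ x ∷ C ∈ insertions x (P ++ C)
∈-insertions⁺ x P C with insertAt-++ x P C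
... | i , eq = subst (_∈ _) eq (∈-map⁺ (λ i → insertAt (P ++ C) i x) (∈-allFin i))

Unique-concatMap-insertions : ∀ {x : A} {xss} → Unique xss → (∀ {xs} → xs ∈ xss → x ∉ xs)
  → Unique (concatMap (insertions x) xss)
Unique-concatMap-insertions {x = x} u-xss x∉ = Unique-concatMap (insertions x) u-xss
  (λ xs∈ → UniqueP.map⁺ (λ eq → Fin.toℕ-injective (proj₂ (insertAt-injective (x∉ xs∈) (x∉ xs∈) eq)))
                         (UniqueP.allFin⁺ _))
  λ xs∈ ys∈ z∈ z∈′ → let (_ , z≡) = ∈-insertions⁻ z∈; (_ , z≡′) = ∈-insertions⁻ z∈′
                     in proj₁ (insertAt-injective (x∉ xs∈) (x∉ ys∈) (trans (sym z≡) z≡′))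

-- Sums over lists

∑ : (A → ℤ) → List A → ℤ
∑ f []       = + 0
∑ f (x ∷ xs) = f x ℤ.+ ∑ f xs

∑-++ : ∀ (f : A → ℤ) xs ys → ∑ f (xs ++ ys) ≡ ∑ f xs ℤ.+ ∑ f ys
∑-++ f []       ys = sym (ℤP.+-identityˡ _)
∑-++ f (x ∷ xs) ys = trans (cong (ℤ._+_ (f x)) (∑-++ f xs ys)) (sym (ℤP.+-assoc (f x) _ _))

∑-map : ∀ (f : B → ℤ) (g : A → B) xs → ∑ f (map g xs) ≡ ∑ (f ∘ g) xs
∑-map f g []       = refl
∑-map f g (x ∷ xs) = cong (ℤ._+_ (f (g x))) (∑-map f g xs)

∑-concatMap : ∀ (f : B → ℤ) (g : A → List B) xs → ∑ f (concatMap g xs) ≡ ∑ (∑ f ∘ g) xs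
∑-concatMap f g []       = refl
∑-concatMap f g (x ∷ xs) = trans (∑-++ f (g x) (concatMap g xs)) (cong (ℤ._+_ (∑ f (g x))) (∑-concatMap f g xs))

∑-cong : ∀ {f g : A → ℤ} xs → (∀ {x} → x ∈ xs → f x ≡ g x) → ∑ f xs ≡ ∑ g xs
∑-cong []       f≗g = refl
∑-cong (x ∷ xs) f≗g = cong₂ ℤ._+_ (f≗g (here refl)) (∑-cong xs (f≗g ∘ there))

∑-↭ : ∀ (f : A → ℤ) {xs ys} → xs ↭ ys → ∑ f xs ≡ ∑ f ys
∑-↭ f ↭-refl         = refl
∑-↭ f (prep x p)     = cong (ℤ._+_ (f x)) (∑-↭ f p)
∑-↭ f (swap x y p)   = trans (cong (λ s → f x ℤ.+ (f y ℤ.+ s)) (∑-↭ f p)) (swap-+ (f x) (f y) _)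
  where swap-+ : ∀ a b c → a ℤ.+ (b ℤ.+ c) ≡ b ℤ.+ (a ℤ.+ c)
        swap-+ = solve-∀
∑-↭ f (↭-trans p q) = trans (∑-↭ f p) (∑-↭ f q)

∑-same-members : ∀ (f : A → ℤ) {xs ys} → Unique xs → Unique ys
  → (∀ {z} → z ∈ xs → z ∈ ys) → (∀ {z} → z ∈ ys → z ∈ xs) → ∑ f xs ≡ ∑ f ys
∑-same-members f u-xs u-ys xs⊆ys ys⊆xs = ∑-↭ f (∼bag⇒↭ (unique∧set⇒bag u-xs u-ys (mk⇔ xs⊆ys ys⊆xs)))

∑-const : ∀ z (xs : List A) → ∑ (λ _ → z) xs ≡ + length xs ℤ.* z
∑-const z []       = sym (ℤP.*-zeroˡ z)
∑-const z (x ∷ xs) = trans (cong (ℤ._+_ z) (∑-const z xs)) (sym (ℤP.suc-* (+ length xs) z))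

∑-*ˡ : ∀ c (f : A → ℤ) xs → ∑ (λ x → c ℤ.* f x) xs ≡ c ℤ.* ∑ f xs
∑-*ˡ c f []       = sym (ℤP.*-zeroʳ c)
∑-*ˡ c f (x ∷ xs) = trans (cong (ℤ._+_ (c ℤ.* f x)) (∑-*ˡ c f xs)) (sym (ℤP.*-distribˡ-+ c (f x) _))

∑-+ : ∀ (f g : A → ℤ) xs → ∑ (λ x → f x ℤ.+ g x) xs ≡ ∑ f xs ℤ.+ ∑ g xs
∑-+ f g []       = refl
∑-+ f g (x ∷ xs) = trans (cong (ℤ._+_ (f x ℤ.+ g x)) (∑-+ f g xs)) (+-interchange (f x) (g x) _ _)

∑-difference : ∀ (f g : A → ℤ) xs → ∑ (λ x → f x ℤ.- g x) xs ≡ ∑ f xs ℤ.- ∑ g xs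
∑-difference f g xs = begin
  ∑ (λ x → f x ℤ.+ ℤ.- g x) xs   ≡⟨ ∑-+ f (ℤ.-_ ∘ g) xs ⟩
  ∑ f xs ℤ.+ ∑ (ℤ.-_ ∘ g) xs     ≡⟨ cong (ℤ._+_ (∑ f xs)) (∑-neg xs) ⟩
  ∑ f xs ℤ.- ∑ g xs              ∎
  where
  open ≡-Reasoning
  ∑-neg : ∀ xs → ∑ (ℤ.-_ ∘ g) xs ≡ ℤ.- ∑ g xs
  ∑-neg []       = refl
  ∑-neg (x ∷ xs) = trans (cong (ℤ._+_ (ℤ.- g x)) (∑-neg xs)) (sym (ℤP.neg-distrib-+ (g x) _))

∑-zero : ∀ {f : A → ℤ} xs → (∀ {x} → x ∈ xs → f x ≡ + 0) → ∑ f xs ≡ + 0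
∑-zero xs f≡0 = trans (∑-cong xs f≡0) (trans (∑-const (+ 0) xs) (ℤP.*-zeroʳ (+ length xs)))

∑-when : ∀ {P : Set} (d : Dec P) (f : A → ℤ) xs → ∑ (λ x → when d (f x)) xs ≡ when d (∑ f xs)
∑-when (yes _) f xs = refl
∑-when (no _)  f xs = ∑-zero xs λ _ → refl

∑-onlyIf : ∀ {P : Set} (d : Dec P) (f : A → ℤ) xs → ∑ f (onlyIf d xs) ≡ when d (∑ f xs)
∑-onlyIf (yes _) f xs = refl
∑-onlyIf (no _)  f xs = refl

sumBelow-cong : ∀ M {f g : ℕ → ℤ} → (∀ m → f m ≡ g m) → sumBelow M f ≡ sumBelow M g
sumBelow-cong zero    f≗g = refl
sumBelow-cong (suc M) f≗g = cong₂ ℤ._+_ (sumBelow-cong M f≗g) (f≗g M)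

sumBelow-∑ : ∀ M (f : ℕ → A → ℤ) xs →
  sumBelow M (λ m → ∑ (f m) xs) ≡ ∑ (λ x → sumBelow M (λ m → f m x)) xs
sumBelow-∑ zero    f xs = sym (∑-zero xs (λ _ → refl))
sumBelow-∑ (suc M) f xs = trans (cong (ℤ._+ ∑ (f M) xs) (sumBelow-∑ M f xs)) (sym (∑-+ _ (f M) xs))

sumBelow-suc : ∀ M (f : ℕ → ℤ) → sumBelow (suc M) f ≡ sumTo M f
sumBelow-suc zero    f = ℤP.+-identityˡ (f 0)
sumBelow-suc (suc M) f = cong (ℤ._+ f (suc M)) (sumBelow-suc M f)

sumBelow-δ : ∀ M l z → l < M → sumBelow M (λ m → δ l m ℤ.* z) ≡ z
sumBelow-δ (suc M) l z (s≤s l≤M) = begin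
  sumBelow (suc M) (λ m → δ l m ℤ.* z) ≡⟨ sumBelow-suc M _ ⟩
  sumTo M (λ m → δ l m ℤ.* z)          ≡⟨ sumTo-cong M (λ m → cong (ℤ._* z) (δ-sym l m)) ⟩
  sumTo M (λ m → δ m l ℤ.* z)          ≡⟨ sumTo-δ M l (λ _ → z) ⟩
  when (l ≤? M) z                      ≡⟨ when-yes (l ≤? M) l≤M z ⟩
  z                                    ∎
  where open ≡-Reasoning

-- Permutations

IsPerm⇒∈ : ∀ {n l v} → IsPerm n l → 1 ≤ v → v ≤ n → v ∈ l
IsPerm⇒∈ {n} {l} {v} (length≡n , bounds , u-l) 1≤v v≤n with v ∈? l
... | yes v∈l = v∈l
... | no v∉l  = ⊥-elim (ℕP.<-irrefl refl (begin-strict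
  n              ≡⟨ sym length≡n ⟩
  length l       <⟨ length≤interval (All.tabulate (λ w∈l v≡w → v∉l (subst (_∈ l) (sym v≡w) w∈l)) ∷ u-l)
                                    ((1≤v , v≤n) ∷ bounds) ⟩
  n              ∎))
  where open ℕP.≤-Reasoning

IsPerm-resp-↭ : ∀ {n xs ys} → xs ↭ ys → IsPerm n xs → IsPerm n ys
IsPerm-resp-↭ xs↭ys (length≡n , bounds , u-xs) =
  trans (sym (PermP.↭-length xs↭ys)) length≡n ,
  PermP.All-resp-↭ xs↭ys bounds ,
  PermₛP.Unique-resp-↭ (↭⇒↭ₛ xs↭ys) u-xs

IsPerm-map-∸ : ∀ {lo n xs} → Unique xs → All (λ x → lo < x × x ≤ lo ℕ.+ n) xs → length xs ≡ n
  → IsPerm n (map (_∸ lo) xs)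
IsPerm-map-∸ {lo} {n} {xs} u-xs bounds length≡n =
  trans (LP.length-map _ xs) length≡n ,
  AllP.map⁺ (All.map (λ (lo<x , x≤lo+n) →
    ℕP.m<n⇒0<n∸m lo<x , subst (_ ≤_) (ℕP.m+n∸m≡n lo n) (ℕP.∸-monoˡ-≤ lo x≤lo+n)) bounds) ,
  Unique-map⁺-on (_∸ lo) (λ x∈xs y∈xs → ℕP.∸-cancelʳ-≡ (lower x∈xs) (lower y∈xs)) u-xs
  where
  lower : ∀ {x} → x ∈ xs → lo ≤ x
  lower x∈xs = ℕP.<⇒≤ (proj₁ (All.lookup bounds x∈xs))

IsPerm-++⁺ : ∀ {m n xs ys} → IsPerm m xs → Unique ys → All (λ y → m < y × y ≤ n) ys → length ys ℕ.+ m ≡ n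
  → IsPerm n (ys ++ xs)
IsPerm-++⁺ {m} {n} {xs} {ys} (length≡m , xs-bounds , u-xs) u-ys ys-bounds length≡n =
  trans (LP.length-++ ys) (trans (cong (length ys ℕ.+_) length≡m) length≡n) ,
  AllP.++⁺ (All.map (λ (m<y , y≤n) → ℕP.≤-trans (s≤s z≤n) m<y , y≤n) ys-bounds)
           (All.map (λ (1≤x , x≤m) → 1≤x , ℕP.≤-trans x≤m m≤n) xs-bounds) ,
  UniqueP.++⁺ u-ys u-xs λ (v∈ys , v∈xs) →
    ℕP.<-irrefl refl (ℕP.<-≤-trans (proj₁ (All.lookup ys-bounds v∈ys)) (proj₂ (All.lookup xs-bounds v∈xs)))
  where
  m≤n : m ≤ n
  m≤n = subst (m ≤_) length≡n (ℕP.m≤n+m m (length ys))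

IsPerm-++⁻ : ∀ {m n xs ys} → IsPerm n (ys ++ xs) → length ys ℕ.+ m ≡ n
  → (∀ {v} → m < v → v ≤ n → v ∈ ys) → IsPerm m xs
IsPerm-++⁻ {m} {n} {xs} {ys} (length≡n , bounds , u-ys++xs) length≡ ys⊇top =
  ℕP.+-cancelˡ-≡ (length ys) _ _ (trans (sym (LP.length-++ ys)) (trans length≡n (sym length≡))) ,
  All.tabulate bounded ,
  Unique-++⁻ʳ ys u-ys++xs
  where
  bounded : ∀ {x} → x ∈ xs → 1 ≤ x × x ≤ m
  bounded {x} x∈xs with All.lookup bounds (∈-++⁺ʳ ys x∈xs)
  ... | 1≤x , x≤n with x ≤? m
  ...   | yes x≤m = 1≤x , x≤m
  ...   | no  x≰m = ⊥-elim (Unique-++⁻-disjoint ys u-ys++xs (ys⊇top (ℕP.≰⇒> x≰m) x≤n) x∈xs)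

Unique-words : ∀ n m → Unique (words n m)
Unique-words n zero    = [] ∷ []
Unique-words n (suc m) = Unique-concatMap (λ x → map (x ∷_) (words n m))
  (UniqueP.map⁺ ℕP.suc-injective (UniqueP.upTo⁺ n))
  (λ _ → UniqueP.map⁺ LP.∷-injectiveʳ (Unique-words n m))
  λ {x} {y} _ _ w∈ w∈′ → let (_ , _ , w≡) = ∈-map⁻ (x ∷_) w∈; (_ , _ , w≡′) = ∈-map⁻ (y ∷_) w∈′
                         in LP.∷-injectiveˡ (trans (sym w≡) w≡′)

∈-words : ∀ n {m l} → length l ≡ m → All (λ x → 1 ≤ x × x ≤ n) l → l ∈ words n m
∈-words n {zero}  {[]}        _      _                        = here refl
∈-words n {suc m} {suc x ∷ l} length≡ ((s≤s z≤n , x<n) ∷ bounds) =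
  ∈-concatMap-intro (λ x → map (x ∷_) (words n m)) (∈-map⁺ suc (∈-upTo⁺ x<n))
    (∈-map⁺ (suc x ∷_) (∈-words n (ℕP.suc-injective length≡) bounds))

Unique-perms : ∀ n → Unique (perms n)
Unique-perms n = UniqueP.filter⁺ (isPerm? n) (Unique-words n n)

∈-perms⁺ : ∀ {n l} → IsPerm n l → l ∈ perms n
∈-perms⁺ {n} perm@(length≡ , bounds , _) = ∈-filter⁺ (isPerm? n) (∈-words n length≡ bounds) perm

∈-perms⁻ : ∀ {n l} → l ∈ perms n → IsPerm n l
∈-perms⁻ {n} l∈ = proj₂ (∈-filter⁻ (isPerm? n) {xs = words n n} l∈)

length-filter-≟ : ∀ (g : A → ℕ) j xs → + length (filter (λ x → g x ℕ.≟ j) xs) ≡ ∑ (λ x → δ (g x) j) xs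
length-filter-≟ g j []       = refl
length-filter-≟ g j (x ∷ xs) = by-cases (g x ℕ.≟ j)
  where
  open ≡-Reasoning
  P? = λ x → g x ℕ.≟ j
  by-cases : Dec (g x ≡ j) → + length (filter P? (x ∷ xs)) ≡ δ (g x) j ℤ.+ ∑ (λ x → δ (g x) j) xs
  by-cases (yes gx≡j) = begin
    + length (filter P? (x ∷ xs))        ≡⟨ cong (+_ ∘ length) (LP.filter-accept P? gx≡j) ⟩
    + 1 ℤ.+ + length (filter P? xs)      ≡⟨ cong₂ ℤ._+_ (sym (trans (cong (λ y → δ y j) gx≡j) (δ-refl j)))
                                                        (length-filter-≟ g j xs) ⟩
    δ (g x) j ℤ.+ ∑ (λ x → δ (g x) j) xs ∎
  by-cases (no gx≢j) = begin
    + length (filter P? (x ∷ xs))        ≡⟨ cong (+_ ∘ length) (LP.filter-reject P? gx≢j) ⟩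
    + length (filter P? xs)              ≡⟨ length-filter-≟ g j xs ⟩
    ∑ (λ x → δ (g x) j) xs               ≡⟨ ℤP.+-identityˡ _ ⟨
    + 0 ℤ.+ ∑ (λ x → δ (g x) j) xs       ≡⟨ cong (ℤ._+ ∑ (λ x → δ (g x) j) xs) (δ-≢ gx≢j) ⟨
    δ (g x) j ℤ.+ ∑ (λ x → δ (g x) j) xs ∎

-- Occurrences of Hertzsprung patterns

+[m+n]-+n≡+m : ∀ m n → + (m ℕ.+ n) ℤ.- + n ≡ + m
+[m+n]-+n≡+m m n = trans (cong (ℤ._- + n) (ℤP.pos-+ m n)) (cancel (+ m) (+ n))
  where cancel : ∀ x y → x ℤ.+ y ℤ.- y ≡ x
        cancel = solve-∀

+m-+n≡+k⇒m≡k+n : ∀ {m n k} → + m ℤ.- + n ≡ + k → m ≡ k ℕ.+ n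
+m-+n≡+k⇒m≡k+n {m} {n} {k} eq = ℤP.+-injective (begin
  + m                   ≡⟨ uncancel (+ m) (+ n) ⟩
  + m ℤ.- + n ℤ.+ + n   ≡⟨ cong (ℤ._+ + n) eq ⟩
  + k ℤ.+ + n           ≡⟨ ℤP.pos-+ k n ⟨
  + (k ℕ.+ n)           ∎)
  where
  open ≡-Reasoning
  uncancel : ∀ x y → x ≡ x ℤ.- y ℤ.+ y
  uncancel = solve-∀

shiftOK-map : ∀ c τ → shiftOK (+ c) τ (map (c ℕ.+_) τ) ≡ true
shiftOK-map c []      = refl
shiftOK-map c (a ∷ τ) with (+ (c ℕ.+ a) ℤ.- + a) ℤ.≟ + c
... | yes _   = shiftOK-map c τ
... | no  c≢c = ⊥-elim (c≢c (+[m+n]-+n≡+m c a))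

hz-map : ∀ τ c → hz τ (map (c ℕ.+_) τ) ≡ true
hz-map []      c = refl
hz-map (a ∷ τ) c rewrite +[m+n]-+n≡+m c a = shiftOK-map c τ

shiftOK-sound : ∀ d as ws → shiftOK d as ws ≡ true → Pointwise (λ a w → + w ℤ.- + a ≡ d) as ws
shiftOK-sound d []       []       _ = []
shiftOK-sound d (a ∷ as) (w ∷ ws) e with (+ w ℤ.- + a) ℤ.≟ d
... | yes w-a≡d = w-a≡d ∷ shiftOK-sound d as ws e

Pointwise-∈ : ∀ {R : A → B → Set} {x xs ys} → x ∈ xs → Pointwise R xs ys → ∃ λ y → y ∈ ys × R x y
Pointwise-∈ (here refl)  (Rxy ∷ _)  = _ , here refl , Rxy
Pointwise-∈ (there x∈xs) (_ ∷ Rxsys) with Pointwise-∈ x∈xs Rxsys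
... | y , y∈ys , Rxy = y , there y∈ys , Rxy

Pointwise-shift⇒≡map : ∀ {c as ws} → Pointwise (λ a w → + w ℤ.- + a ≡ + c) as ws → ws ≡ map (c ℕ.+_) as
Pointwise-shift⇒≡map []             = refl
Pointwise-shift⇒≡map (w-a≡c ∷ rest) = cong₂ _∷_ (+m-+n≡+k⇒m≡k+n w-a≡c) (Pointwise-shift⇒≡map rest)

-- 1 ∈ τ and positivity of the word make the shift b - a nonnegative, so truncated subtraction is exact.
hz-sound : ∀ {a as b ws} → 1 ∈ a ∷ as → All (1 ≤_) (b ∷ ws) → hz (a ∷ as) (b ∷ ws) ≡ true
  → b ∷ ws ≡ map ((b ∸ a) ℕ.+_) (a ∷ as)
hz-sound {a} {as} {b} {ws} 1∈τ positive e =
  Pointwise-shift⇒≡map (subst (λ d → Pointwise (λ x w → + w ℤ.- + x ≡ d) (a ∷ as) (b ∷ ws)) b-a≡+[b∸a] pointwise)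
  where
  pointwise : Pointwise (λ x w → + w ℤ.- + x ≡ + b ℤ.- + a) (a ∷ as) (b ∷ ws)
  pointwise = refl ∷ shiftOK-sound _ as ws e
  a≤b : a ≤ b
  a≤b with Pointwise-∈ 1∈τ pointwise
  ... | w , w∈ , w-1≡b-a with All.lookup positive w∈
  ...   | s≤s {n = w'} _ = subst (a ≤_) (sym (+m-+n≡+k⇒m≡k+n (sym w-1≡b-a))) (ℕP.m≤n+m a w')
  b-a≡+[b∸a] : + b ℤ.- + a ≡ + (b ∸ a)
  b-a≡+[b∸a] = trans (cong (λ b → + b ℤ.- + a) (sym (ℕP.m∸n+n≡m a≤b))) (+[m+n]-+n≡+m (b ∸ a) a)

occ-∷-true : ∀ τ b π → hz τ (take (length τ) (b ∷ π)) ≡ true → occ τ (b ∷ π) ≡ suc (occ τ π)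
occ-∷-true τ b π e with hz τ (take (length τ) (b ∷ π))
occ-∷-true τ b π refl | true = refl

occ-∷-false : ∀ τ b π → hz τ (take (length τ) (b ∷ π)) ≡ false → occ τ (b ∷ π) ≡ occ τ π
occ-∷-false τ b π e with hz τ (take (length τ) (b ∷ π))
occ-∷-false τ b π refl | false = refl

occ-drop : ∀ τ i π → (∀ {p} → p < i → hz τ (take (length τ) (drop p π)) ≡ false) → occ τ π ≡ occ τ (drop i π)
occ-drop τ zero    π        _         = refl
occ-drop τ (suc i) []       _         = refl
occ-drop τ (suc i) (b ∷ π) no-occ<i =
  trans (occ-∷-false τ b π (no-occ<i (s≤s z≤n))) (occ-drop τ i π (no-occ<i ∘ s≤s))

close-shifts : ∀ {q k lo hi} → q < k → k ∸ q ≤ (lo ℕ.+ k) ∸ hi → hi ≤ lo ℕ.+ q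
close-shifts {q} {k} {lo} {hi} q<k k∸q≤ = ℕP.+-cancelˡ-≤ (k ∸ q) hi (lo ℕ.+ q) (begin
  k ∸ q ℕ.+ hi          ≤⟨ ℕP.m≤o∸n⇒m+n≤o (k ∸ q) (ℕP.<⇒≤ hi<lo+k) k∸q≤ ⟩
  lo ℕ.+ k              ≡⟨ cong (lo ℕ.+_) (ℕP.m∸n+n≡m (ℕP.<⇒≤ q<k)) ⟨
  lo ℕ.+ (k ∸ q ℕ.+ q)  ≡⟨ +-swap lo (k ∸ q) q ⟩
  k ∸ q ℕ.+ (lo ℕ.+ q)  ∎)
  where
  open ℕP.≤-Reasoning
  hi<lo+k : hi < lo ℕ.+ k
  hi<lo+k = ℕP.m∸n≢0⇒n<m λ eq → ℕP.<⇒≱ (ℕP.m<n⇒0<n∸m q<k) (subst (k ∸ q ≤_) eq k∸q≤)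
  +-swap : ∀ x y z → x ℕ.+ (y ℕ.+ z) ≡ y ℕ.+ (x ℕ.+ z)
  +-swap = ℕS.solve-∀

-- the coefficient of u^j in (u - 1)^b
signedBinomial : ℕ → ℕ → ℤ
signedBinomial zero    j = δ 0 j
signedBinomial (suc b) j = when (1 ≤? j) (signedBinomial b (j ∸ 1)) ℤ.- signedBinomial b j

∑-signedBinomial-suc : ∀ (b : A → ℕ) j xs → ∑ (λ x → signedBinomial (suc (b x)) j) xs
  ≡ when (1 ≤? j) (∑ (λ x → signedBinomial (b x) (j ∸ 1)) xs) ℤ.- ∑ (λ x → signedBinomial (b x) j) xs
∑-signedBinomial-suc b j xs =
  trans (∑-difference (λ x → when (1 ≤? j) (signedBinomial (b x) (j ∸ 1))) (λ x → signedBinomial (b x) j) xs)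
        (cong (ℤ._- ∑ (λ x → signedBinomial (b x) j) xs) (∑-when (1 ≤? j) (λ x → signedBinomial (b x) (j ∸ 1)) xs))

δ-step : ∀ o j → δ o j ℤ.+ (when (1 ≤? j) (δ o (j ∸ 1)) ℤ.- δ o j) ≡ δ (suc o) j
δ-step o j = trans (cong (λ s → δ o j ℤ.+ (s ℤ.- δ o j)) (when-δ-pred o j)) (cancel (δ o j) (δ (suc o) j))
  where cancel : ∀ x y → x ℤ.+ (y ℤ.- x) ≡ y
        cancel = solve-∀

module Pattern (a : ℕ) (as : List ℕ) where

  τ : List ℕ
  τ = a ∷ as

  k : ℕ
  k = length τ

  data Piece : Set where
    single : ℕ → Piece
    block  : ℕ → Piece

  values : Piece → List ℕ
  values (single v) = v ∷ []
  values (block c)  = map (c ℕ.+_) τ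

  flatten : List Piece → List ℕ
  flatten = concatMap values

  blocks : List Piece → ℕ
  blocks []              = 0
  blocks (single _ ∷ ps) = blocks ps
  blocks (block _ ∷ ps)  = suc (blocks ps)

  length-values : ∀ c → length (values (block c)) ≡ k
  length-values c = cong suc (LP.length-map (c ℕ.+_) as)

  blockAt? : ∀ b π → Dec (take k (b ∷ π) ≡ values (block (b ∸ a)))
  blockAt? b π = LP.≡-dec ℕ._≟_ _ _

  -- The ways of cutting π into single letters and marked occurrences of τ (f is fuel: length π < f).
  segmentations : ℕ → List ℕ → List (List Piece)
  segmentations zero    _       = []
  segmentations (suc f) []      = [] ∷ []
  segmentations (suc f) (b ∷ π) =
    map (single b ∷_) (segmentations f π) ++
    onlyIf (blockAt? b π) (map (block (b ∸ a) ∷_) (segmentations f (drop k (b ∷ π))))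

  flatten-segmentations : ∀ f π {ps} → ps ∈ segmentations f π → flatten ps ≡ π
  flatten-segmentations (suc f) []      (here refl) = refl
  flatten-segmentations (suc f) (b ∷ π) ps∈ with ∈-++⁻ (map (single b ∷_) (segmentations f π)) ps∈
  ... | inj₁ ps∈singles with ∈-map⁻ (single b ∷_) ps∈singles
  ...   | ps , ps∈ , refl = cong (b ∷_) (flatten-segmentations f π ps∈)
  flatten-segmentations (suc f) (b ∷ π) ps∈ | inj₂ ps∈blocks with ∈-onlyIf⁻ (blockAt? b π) ps∈blocks
  ... | take≡block , ps∈blocks′ with ∈-map⁻ (block (b ∸ a) ∷_) ps∈blocks′
  ...   | ps , ps∈ , refl = begin
    map ((b ∸ a) ℕ.+_) τ ++ flatten ps             ≡⟨ cong₂ _++_ (sym take≡block) (flatten-segmentations f _ ps∈) ⟩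
    take k (b ∷ π) ++ drop k (b ∷ π)               ≡⟨ LP.take++drop≡id k (b ∷ π) ⟩
    b ∷ π                                          ∎
    where open ≡-Reasoning

  ∈-segmentations : ∀ f ps → length (flatten ps) < f → ps ∈ segmentations f (flatten ps)
  ∈-segmentations (suc f) []              _        = here refl
  ∈-segmentations (suc f) (single b ∷ ps) (s≤s lt) = ∈-++⁺ˡ (∈-map⁺ (single b ∷_) (∈-segmentations f ps lt))
  ∈-segmentations (suc f) (block c ∷ ps)  (s≤s lt) =
    ∈-++⁺ʳ (map (single (c ℕ.+ a) ∷_) _) (∈-onlyIf⁺ (blockAt? (c ℕ.+ a) rest) starts-with-block
      (subst₂ (λ c′ π′ → block c ∷ ps ∈ map (block c′ ∷_) (segmentations f π′))
        (sym (ℕP.m+n∸n≡m c a)) (sym (drop-++ (values (block c)) (flatten ps) (length-values c)))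
        (∈-map⁺ (block c ∷_) (∈-segmentations f ps ps<f))))
    where
    rest : List ℕ
    rest = map (c ℕ.+_) as ++ flatten ps
    ps<f : length (flatten ps) < f
    ps<f = ℕP.≤-<-trans (ℕP.m≤n+m _ (length (map (c ℕ.+_) as))) (subst (_< f) (LP.length-++ (map (c ℕ.+_) as)) lt)
    starts-with-block : take k ((c ℕ.+ a) ∷ rest) ≡ map ((c ℕ.+ a ∸ a) ℕ.+_) τ
    starts-with-block = trans (take-++ (values (block c)) (flatten ps) (length-values c))
                              (cong (λ c′ → map (c′ ℕ.+_) τ) (sym (ℕP.m+n∸n≡m c a)))

  Unique-segmentations : ∀ f π → Unique (segmentations f π)
  Unique-segmentations zero    _       = []
  Unique-segmentations (suc f) []      = [] ∷ []
  Unique-segmentations (suc f) (b ∷ π) =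
    UniqueP.++⁺ (UniqueP.map⁺ LP.∷-injectiveʳ (Unique-segmentations f π))
                (Unique-onlyIf (blockAt? b π) (UniqueP.map⁺ LP.∷-injectiveʳ (Unique-segmentations f _)))
                single≢block
    where
    single≢block : ∀ {ps} → ps ∈ map (single b ∷_) (segmentations f π) × ps ∈ onlyIf (blockAt? b π) _ → ⊥
    single≢block (ps∈₁ , ps∈₂)
      with ∈-map⁻ (single b ∷_) ps∈₁ | ∈-map⁻ (block (b ∸ a) ∷_) (proj₂ (∈-onlyIf⁻ (blockAt? b π) ps∈₂))
    ... | _ , _ , refl | _ , _ , ()

  flatten-insertAt : ∀ ps i p → flatten (insertAt ps i p) ↭ values p ++ flatten ps
  flatten-insertAt ps       zero    p = ↭-refl
  flatten-insertAt (q ∷ ps) (suc i) p =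
    ↭-trans (PermP.++⁺ˡ (values q) (flatten-insertAt ps i p)) (PermP.shifts (values q) (values p))

  flatten-middle : ∀ P p C → flatten (P ++ p ∷ C) ↭ values p ++ flatten (P ++ C)
  flatten-middle []      p C = ↭-refl
  flatten-middle (q ∷ P) p C =
    ↭-trans (PermP.++⁺ˡ (values q) (flatten-middle P p C)) (PermP.shifts (values q) (values p))

  blocks-insertAt : ∀ ps i p → blocks (insertAt ps i p) ≡ blocks (p ∷ ps)
  blocks-insertAt ps              zero    p          = refl
  blocks-insertAt (single _ ∷ ps) (suc i) (single _) = blocks-insertAt ps i (single _)
  blocks-insertAt (single _ ∷ ps) (suc i) (block _)  = blocks-insertAt ps i (block _)
  blocks-insertAt (block _ ∷ ps)  (suc i) (single _) = cong suc (blocks-insertAt ps i (single _))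
  blocks-insertAt (block _ ∷ ps)  (suc i) (block _)  = cong suc (blocks-insertAt ps i (block _))

  ∈-flatten⁻ : ∀ {v} ps → v ∈ flatten ps → ∃ λ P → ∃ λ p → ∃ λ C → ps ≡ P ++ p ∷ C × v ∈ values p
  ∈-flatten⁻ ps v∈ with find (∈-concatMap⁻ values {xs = ps} v∈)
  ... | p , p∈ps , v∈p with ∈-∃++ p∈ps
  ...   | P , C , ps≡ = P , p , C , ps≡ , v∈p

  length≤length-flatten : ∀ ps → length ps ≤ length (flatten ps)
  length≤length-flatten []              = z≤n
  length≤length-flatten (single _ ∷ ps) = s≤s (length≤length-flatten ps)
  length≤length-flatten (block c ∷ ps)  = begin
    suc (length ps)                                    ≤⟨ s≤s (length≤length-flatten ps) ⟩
    suc (length (flatten ps))                          ≤⟨ s≤s (ℕP.m≤n+m _ (length (map (c ℕ.+_) as))) ⟩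
    suc (length (map (c ℕ.+_) as) ℕ.+ length (flatten ps)) ≡⟨ cong suc (LP.length-++ (map (c ℕ.+_) as)) ⟨
    length (flatten (block c ∷ ps))                    ∎
    where open ℕP.≤-Reasoning

  -- Piece lists flattening to a permutation of [n], generated by inserting the piece that contains n
  -- into a piece list for the smaller values (f is fuel: n ≤ f).
  enumerate : ℕ → ℕ → List (List Piece)
  enumerate _       zero    = [] ∷ []
  enumerate zero    (suc n) = []
  enumerate (suc f) (suc n) =
    concatMap (insertions (single (suc n))) (enumerate f n) ++
    onlyIf (k ≤? suc n) (concatMap (insertions (block (suc n ∸ k))) (enumerate f (suc n ∸ k)))

  suc-∸-k≤ : ∀ n → suc n ∸ k ≤ n
  suc-∸-k≤ n = ℕP.∸-monoʳ-≤ {1} {k} (suc n) (s≤s z≤n)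

  enumerate-fuel : ∀ f g n → n ≤ f → n ≤ g → enumerate f n ≡ enumerate g n
  enumerate-fuel f       g       zero    _         _         = refl
  enumerate-fuel (suc f) (suc g) (suc n) (s≤s n≤f) (s≤s n≤g) =
    cong₂ (λ xss yss → concatMap (insertions (single (suc n))) xss ++
                       onlyIf (k ≤? suc n) (concatMap (insertions (block (suc n ∸ k))) yss))
      (enumerate-fuel f g n n≤f n≤g)
      (enumerate-fuel f g (suc n ∸ k) (ℕP.≤-trans (suc-∸-k≤ n) n≤f) (ℕP.≤-trans (suc-∸-k≤ n) n≤g))

  shift⇒T-hz : ∀ {w} c → w ≡ map (c ℕ.+_) τ → T (hz τ w)
  shift⇒T-hz c refl rewrite hz-map τ c = _

  module WellFormed (τ-perm : IsPerm k τ) where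

    1∈τ : 1 ∈ τ
    1∈τ = IsPerm⇒∈ τ-perm ℕP.≤-refl (s≤s z≤n)

    k∈τ : k ∈ τ
    k∈τ = IsPerm⇒∈ τ-perm (s≤s z≤n) ℕP.≤-refl

    Unique-block : ∀ c → Unique (values (block c))
    Unique-block c = UniqueP.map⁺ (ℕP.+-cancelˡ-≡ c _ _) (proj₂ (proj₂ τ-perm))

    ∈-block : ∀ {c y} → y ∈ values (block c) → c < y × y ≤ c ℕ.+ k
    ∈-block {c} y∈ with ∈-map⁻ (c ℕ.+_) y∈
    ... | t , t∈τ , refl with All.lookup (proj₁ (proj₂ τ-perm)) t∈τ
    ...   | 1≤t , t≤k = ℕP.m<m+n c 1≤t , ℕP.+-monoʳ-≤ c t≤k

    occurrence⇒block : ∀ {w} → All (1 ≤_) w → hz τ w ≡ true → ∃ λ c → w ≡ values (block c)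
    occurrence⇒block {b ∷ ws} positive occurs = b ∸ a , hz-sound 1∈τ positive occurs

    occ-∷-block : ∀ {b π} → take k (b ∷ π) ≡ values (block (b ∸ a)) → occ τ (b ∷ π) ≡ suc (occ τ π)
    occ-∷-block {b} {π} starts-block = occ-∷-true τ b π (trans (cong (hz τ) starts-block) (hz-map τ (b ∸ a)))

    occ-∷-¬block : ∀ {b π} → All (1 ≤_) (b ∷ π) → take k (b ∷ π) ≢ values (block (b ∸ a)) → occ τ (b ∷ π) ≡ occ τ π
    occ-∷-¬block {b} {π} pos not-block = occ-∷-false τ b π no-occurrence
      where
      no-occurrence : hz τ (take k (b ∷ π)) ≡ false
      no-occurrence with hz τ (take k (b ∷ π)) in occurs
      ... | false = refl
      ... | true  = ⊥-elim (not-block (hz-sound 1∈τ (AllP.take⁺ k pos) occurs))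

    -- The k - q shared values lie in both intervals (c, c + k] and (c′, c′ + k], which therefore
    -- overlap in at least k - q integers.
    overlapping-blocks-close : ∀ {q c c′} → q < k → take (k ∸ q) (values (block c′)) ⊆ values (block c)
      → c ℕ.⊔ c′ ≤ c ℕ.⊓ c′ ℕ.+ q
    overlapping-blocks-close {q} {c} {c′} q<k shared⊆ = close-shifts q<k (subst (_≤ _) length-Y
      (length≤interval (UniqueP.take⁺ (k ∸ q) (Unique-block c′)) (All.tabulate Y-bounds)))
      where
      Y : List ℕ
      Y = take (k ∸ q) (values (block c′))
      length-Y : length Y ≡ k ∸ q
      length-Y = trans (LP.length-take (k ∸ q) (values (block c′)))
                   (trans (cong ((k ∸ q) ℕ.⊓_) (length-values c′)) (ℕP.m≤n⇒m⊓n≡m (ℕP.m∸n≤m k q)))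
      Y-bounds : ∀ {y} → y ∈ Y → c ℕ.⊔ c′ < y × y ≤ c ℕ.⊓ c′ ℕ.+ k
      Y-bounds {y} y∈Y =
        let c<y , y≤c+k   = ∈-block (shared⊆ y∈Y)
            c′<y , y≤c′+k = ∈-block (∈-take (k ∸ q) y∈Y)
        in ℕP.⊔-lub c<y c′<y , subst (y ≤_) (sym (ℕP.+-distribʳ-⊓ k c c′)) (ℕP.⊓-glb y≤c+k y≤c′+k)

    block-within : ∀ {lo q d x} → lo ≤ d → d ≤ lo ℕ.+ q → x ∈ values (block d) → lo < x × x ≤ lo ℕ.+ (q ℕ.+ k)
    block-within {lo} {q} {d} {x} lo≤d d≤lo+q x∈ with ∈-block x∈
    ... | d<x , x≤d+k = ℕP.≤-<-trans lo≤d d<x , (begin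
      x                   ≤⟨ x≤d+k ⟩
      d ℕ.+ k             ≤⟨ ℕP.+-monoˡ-≤ k d≤lo+q ⟩
      lo ℕ.+ q ℕ.+ k      ≡⟨ ℕP.+-assoc lo q k ⟩
      lo ℕ.+ (q ℕ.+ k)    ∎)
      where open ℕP.≤-Reasoning

    -- Subtracting lo standardises F to a permutation σ of [q + k] with τ as prefix and suffix.
    prefix-suffix⇒SelfOverlapping : ∀ {q lo c c′ F} → 1 ≤ q → q < k
      → Unique F → All (λ x → lo < x × x ≤ lo ℕ.+ (q ℕ.+ k)) F → length F ≡ q ℕ.+ k
      → take k F ≡ values (block c) → drop q F ≡ values (block c′) → lo ≤ c → lo ≤ c′
      → SelfOverlapping τ
    prefix-suffix⇒SelfOverlapping {q} {lo} {c} {c′} {F} 1≤q q<k u-F bounds length-F prefix suffix lo≤c lo≤c′ =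
      σ , subst (λ n → IsPerm n σ) (sym length-σ) (IsPerm-map-∸ u-F bounds length-F) , k<σ , σ<2k ,
      shift⇒T-hz (c ∸ lo) τ-prefix , shift⇒T-hz (c′ ∸ lo) τ-suffix
      where
      σ : List ℕ
      σ = map (_∸ lo) F

      length-σ : length σ ≡ q ℕ.+ k
      length-σ = trans (LP.length-map _ F) length-F

      k<σ : k < length σ
      k<σ = subst (k <_) (sym length-σ) (ℕP.m<n+m k 1≤q)

      σ<2k : length σ < 2 ℕ.* k
      σ<2k = subst₂ _<_ (sym length-σ) (cong (k ℕ.+_) (sym (ℕP.+-identityʳ k))) (ℕP.+-monoˡ-< k q<k)

      τ-prefix : take k σ ≡ map ((c ∸ lo) ℕ.+_) τ
      τ-prefix = begin
        take k (map (_∸ lo) F)          ≡⟨ LP.take-map k F ⟩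
        map (_∸ lo) (take k F)          ≡⟨ cong (map (_∸ lo)) prefix ⟩
        map (_∸ lo) (values (block c))  ≡⟨ map-∸-shift τ lo≤c ⟩
        map ((c ∸ lo) ℕ.+_) τ           ∎
        where open ≡-Reasoning

      τ-suffix : drop (length σ ∸ k) σ ≡ map ((c′ ∸ lo) ℕ.+_) τ
      τ-suffix = begin
        drop (length σ ∸ k) σ           ≡⟨ cong (λ n → drop n σ) (trans (cong (_∸ k) length-σ) (ℕP.m+n∸n≡m q k)) ⟩
        drop q (map (_∸ lo) F)          ≡⟨ LP.drop-map q F ⟩
        map (_∸ lo) (drop q F)          ≡⟨ cong (map (_∸ lo)) suffix ⟩
        map (_∸ lo) (values (block c′)) ≡⟨ map-∸-shift τ lo≤c′ ⟩
        map ((c′ ∸ lo) ℕ.+_) τ          ∎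
        where open ≡-Reasoning

    overlap⇒SelfOverlapping : ∀ {q X c c′} → length X ≡ q → 1 ≤ q → q < k
      → Unique (X ++ values (block c′))
      → X ++ take (k ∸ q) (values (block c′)) ≡ values (block c)
      → SelfOverlapping τ
    overlap⇒SelfOverlapping {q} {X} {c} {c′} refl 1≤q q<k u-F prefix≡ =
      prefix-suffix⇒SelfOverlapping 1≤q q<k u-F F-bounds length-F
        (trans (take-++-≥ X W (ℕP.<⇒≤ q<k)) prefix≡) (drop-++ X W refl) (ℕP.m⊓n≤m c c′) (ℕP.m⊓n≤n c c′)
      where
      W : List ℕ
      W = values (block c′)
      c⊔c′≤ : c ℕ.⊔ c′ ≤ c ℕ.⊓ c′ ℕ.+ q
      c⊔c′≤ = overlapping-blocks-close q<k (λ y∈ → subst (_ ∈_) prefix≡ (∈-++⁺ʳ X y∈))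
      length-F : length (X ++ W) ≡ q ℕ.+ k
      length-F = trans (LP.length-++ X) (cong (q ℕ.+_) (length-values c′))
      F-bounds : All (λ x → c ℕ.⊓ c′ < x × x ≤ c ℕ.⊓ c′ ℕ.+ (q ℕ.+ k)) (X ++ W)
      F-bounds = AllP.++⁺
        (All.tabulate λ x∈X → block-within (ℕP.m⊓n≤m c c′) (ℕP.≤-trans (ℕP.m≤m⊔n c c′) c⊔c′≤)
                                            (subst (_ ∈_) prefix≡ (∈-++⁺ˡ x∈X)))
        (All.tabulate (block-within (ℕP.m⊓n≤n c c′) (ℕP.≤-trans (ℕP.m≤n⊔m c c′) c⊔c′≤)))

    IsPerm-insertAt : ∀ {m n ps} i p → IsPerm m (flatten ps) → Unique (values p)
      → All (λ y → m < y × y ≤ n) (values p) → length (values p) ℕ.+ m ≡ n → IsPerm n (flatten (insertAt ps i p))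
    IsPerm-insertAt {ps = ps} i p perm u-p p-bounds length≡ =
      IsPerm-resp-↭ (↭-sym (flatten-insertAt ps i p)) (IsPerm-++⁺ perm u-p p-bounds length≡)

    block-bounds : ∀ c → All (λ y → c < y × y ≤ c ℕ.+ k) (values (block c))
    block-bounds c = All.tabulate ∈-block

    block-covers : ∀ c {v} → c < v → v ≤ c ℕ.+ k → v ∈ values (block c)
    block-covers c {v} c<v v≤c+k = subst (_∈ _) (ℕP.m+[n∸m]≡n (ℕP.<⇒≤ c<v))
      (∈-map⁺ (c ℕ.+_) (IsPerm⇒∈ τ-perm (ℕP.m<n⇒0<n∸m c<v) (subst (v ∸ c ≤_) (ℕP.m+n∸m≡n c k) (ℕP.∸-monoˡ-≤ c v≤c+k))))

    IsPerm-enumerate : ∀ f n {ps} → ps ∈ enumerate f n → IsPerm n (flatten ps)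
    IsPerm-enumerate f       zero    (here refl) = refl , [] , []
    IsPerm-enumerate (suc f) (suc n) ps∈ with ∈-++⁻ (concatMap (insertions (single (suc n))) (enumerate f n)) ps∈
    ... | inj₁ ps∈₁ with find (∈-concatMap⁻ (insertions (single (suc n))) {xs = enumerate f n} ps∈₁)
    ...   | ps′ , ps′∈ , ps∈ins with ∈-insertions⁻ ps∈ins
    ...     | i , refl = IsPerm-insertAt {ps = ps′} i (single (suc n)) (IsPerm-enumerate f n ps′∈) ([] ∷ [])
                           ((ℕP.≤-refl , ℕP.≤-refl) ∷ []) refl
    IsPerm-enumerate (suc f) (suc n) ps∈ | inj₂ ps∈₂ with ∈-onlyIf⁻ (k ≤? suc n) ps∈₂
    ... | k≤1+n , ps∈₂′ with find (∈-concatMap⁻ (insertions (block (suc n ∸ k))) {xs = enumerate f (suc n ∸ k)} ps∈₂′)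
    ...   | ps′ , ps′∈ , ps∈ins with ∈-insertions⁻ ps∈ins
    ...     | i , refl = IsPerm-insertAt {ps = ps′} i (block (suc n ∸ k)) (IsPerm-enumerate f (suc n ∸ k) ps′∈)
                           (Unique-block (suc n ∸ k))
                           (subst (λ m → All (λ y → suc n ∸ k < y × y ≤ m) (values (block (suc n ∸ k)))) (ℕP.m∸n+n≡m k≤1+n)
                             (block-bounds (suc n ∸ k)))
                           (trans (cong (ℕ._+ (suc n ∸ k)) (length-values (suc n ∸ k))) (ℕP.m+[n∸m]≡n k≤1+n))

    ∈-enumerate : ∀ f n {ps} → n ≤ f → IsPerm n (flatten ps) → ps ∈ enumerate f n
    ∈-enumerate f zero {[]} _ _ = here refl
    ∈-enumerate f zero {p ∷ ps} _ (length≡0 , _) =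
      ⊥-elim (ℕP.<-irrefl refl (ℕP.<-≤-trans (s≤s z≤n) (subst (_ ≤_) length≡0 (length≤length-flatten (p ∷ ps)))))
    ∈-enumerate (suc f) (suc n) {ps} (s≤s n≤f) perm with ∈-flatten⁻ ps (IsPerm⇒∈ perm (s≤s z≤n) ℕP.≤-refl)
    ... | P , single _ , C , refl , here refl =
      ∈-++⁺ˡ (∈-concatMap-intro (insertions (single (suc n)))
               (∈-enumerate f n n≤f (IsPerm-++⁻ (IsPerm-resp-↭ (flatten-middle P _ C) perm) refl top))
               (∈-insertions⁺ _ P C))
      where
      top : ∀ {v} → n < v → v ≤ suc n → v ∈ suc n ∷ []
      top n<v v≤1+n = here (ℕP.≤-antisym v≤1+n n<v)
    ... | P , block c , C , refl , 1+n∈ =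
      ∈-++⁺ʳ _ (∈-onlyIf⁺ (k ≤? suc n) k≤1+n
        (subst (λ c′ → P ++ block c ∷ C ∈ concatMap (insertions (block c′)) (enumerate f c′)) (sym c≡)
          (∈-concatMap-intro (insertions (block c)) (∈-enumerate f c c≤f rest-perm) (∈-insertions⁺ _ P C))))
      where
      middle-perm : IsPerm (suc n) (values (block c) ++ flatten (P ++ C))
      middle-perm = IsPerm-resp-↭ (flatten-middle P _ C) perm
      c+k≡1+n : c ℕ.+ k ≡ suc n
      c+k≡1+n = ℕP.≤-antisym (proj₂ (All.lookup (proj₁ (proj₂ middle-perm)) (∈-++⁺ˡ (∈-map⁺ (c ℕ.+_) k∈τ))))
                              (proj₂ (∈-block 1+n∈))
      k≤1+n : k ≤ suc n
      k≤1+n = subst (k ≤_) c+k≡1+n (ℕP.m≤n+m k c)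
      c≡ : suc n ∸ k ≡ c
      c≡ = trans (cong (_∸ k) (sym c+k≡1+n)) (ℕP.m+n∸n≡m c k)
      c≤f : c ≤ f
      c≤f = ℕP.≤-trans (subst (_≤ n) c≡ (suc-∸-k≤ n)) n≤f
      rest-perm : IsPerm c (flatten (P ++ C))
      rest-perm = IsPerm-++⁻ middle-perm (trans (cong (ℕ._+ c) (length-values c)) (trans (ℕP.+-comm k c) c+k≡1+n))
                    λ {v} c<v v≤1+n → block-covers c c<v (subst (v ≤_) (sym c+k≡1+n) v≤1+n)

    ∈-flatten-enumerate-≤ : ∀ {f n ps v} → ps ∈ enumerate f n → v ∈ flatten ps → v ≤ n
    ∈-flatten-enumerate-≤ ps∈ v∈ = proj₂ (All.lookup (proj₁ (proj₂ (IsPerm-enumerate _ _ ps∈))) v∈)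

    Unique-enumerate : ∀ f n → Unique (enumerate f n)
    Unique-enumerate f       zero    = [] ∷ []
    Unique-enumerate zero    (suc n) = []
    Unique-enumerate (suc f) (suc n) =
      UniqueP.++⁺ (Unique-concatMap-insertions (Unique-enumerate f n) single∉)
                  (Unique-onlyIf (k ≤? suc n) (Unique-concatMap-insertions (Unique-enumerate f c) block∉))
                  disjoint
      where
      c : ℕ
      c = suc n ∸ k
      single∉ : ∀ {ps} → ps ∈ enumerate f n → single (suc n) ∉ ps
      single∉ ps∈ single∈ = ℕP.<-irrefl refl (∈-flatten-enumerate-≤ ps∈ (∈-concatMap-intro values single∈ (here refl)))
      block∉ : ∀ {ps} → ps ∈ enumerate f c → block c ∉ ps
      block∉ ps∈ block∈ = ℕP.<-irrefl refl (ℕP.<-≤-trans (proj₁ (∈-block (here refl)))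
                            (∈-flatten-enumerate-≤ ps∈ (∈-concatMap-intro values block∈ (here refl))))
      disjoint : ∀ {ps} → ps ∈ concatMap (insertions (single (suc n))) (enumerate f n)
                        × ps ∈ onlyIf (k ≤? suc n) (concatMap (insertions (block c)) (enumerate f c)) → ⊥
      disjoint (ps∈₁ , ps∈₂)
        with find (∈-concatMap⁻ (insertions (single (suc n))) {xs = enumerate f n} ps∈₁)
           | find (∈-concatMap⁻ (insertions (block c)) {xs = enumerate f c} (proj₂ (∈-onlyIf⁻ (k ≤? suc n) ps∈₂)))
      ... | ps₁ , _ , ps∈ins₁ | ps₂ , ps₂∈ , ps∈ins₂ with ∈-insertions⁻ ps∈ins₁ | ∈-insertions⁻ ps∈ins₂
      ...   | i , refl | j , eq with ∈-insertAt⁻ ps₂ j (subst (single (suc n) ∈_) eq (x∈insertAt ps₁ i _))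
      ...     | inj₂ single∈ps₂ = ℕP.<-irrefl refl (ℕP.≤-trans
                  (∈-flatten-enumerate-≤ ps₂∈ (∈-concatMap-intro values single∈ps₂ (here refl))) (suc-∸-k≤ n))

    weight : ℕ → ℕ → List Piece → ℤ
    weight m j ps = δ (length ps) m ℤ.* signedBinomial (blocks ps) j

    D : ℕ → Series
    D m n j = ∑ (weight m j) (enumerate n n)

    ∑-insertions : ∀ m j p ps → ∑ (weight (suc m) j) (insertions p ps)
      ≡ + suc m ℤ.* (δ (length ps) m ℤ.* signedBinomial (blocks (p ∷ ps)) j)
    ∑-insertions m j p ps = begin
      ∑ (weight (suc m) j) (insertions p ps)
        ≡⟨ ∑-cong (insertions p ps) (λ ys∈ → let (i , ys≡) = ∈-insertions⁻ ys∈ in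
             trans (cong (weight (suc m) j) ys≡)
                   (cong₂ (λ l b → δ l (suc m) ℤ.* signedBinomial b j)
                          (LP.length-insertAt ps i p) (blocks-insertAt ps i p))) ⟩
      ∑ (λ _ → δ (suc (length ps)) (suc m) ℤ.* b) (insertions p ps)
        ≡⟨ ∑-const (δ (suc (length ps)) (suc m) ℤ.* b) (insertions p ps) ⟩
      + length (insertions p ps) ℤ.* (δ (suc (length ps)) (suc m) ℤ.* b)
        ≡⟨ cong (λ l → + l ℤ.* (δ (suc (length ps)) (suc m) ℤ.* b)) (length-insertions p ps) ⟩
      + suc (length ps) ℤ.* (δ (suc (length ps)) (suc m) ℤ.* b)
        ≡⟨ +suc*δ-suc (length ps) m b ⟩
      + suc m ℤ.* (δ (length ps) m ℤ.* b) ∎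
      where
      open ≡-Reasoning
      b : ℤ
      b = signedBinomial (blocks (p ∷ ps)) j

    ∑-concatMap-insertions : ∀ m j p xss → ∑ (weight (suc m) j) (concatMap (insertions p) xss)
      ≡ + suc m ℤ.* ∑ (λ ps → δ (length ps) m ℤ.* signedBinomial (blocks (p ∷ ps)) j) xss
    ∑-concatMap-insertions m j p xss =
      trans (∑-concatMap (weight (suc m) j) (insertions p) xss)
        (trans (∑-cong xss (λ {ps} _ → ∑-insertions m j p ps)) (∑-*ˡ (+ suc m) _ xss))

    ∑-weight-block : ∀ m j c xss → ∑ (λ ps → δ (length ps) m ℤ.* signedBinomial (blocks (block c ∷ ps)) j) xss
      ≡ when (1 ≤? j) (∑ (weight m (j ∸ 1)) xss) ℤ.- ∑ (weight m j) xss
    ∑-weight-block m j c xss = begin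
      ∑ (λ ps → δ (length ps) m ℤ.* (when (1 ≤? j) (signedBinomial (blocks ps) (j ∸ 1))
                                      ℤ.- signedBinomial (blocks ps) j)) xss
        ≡⟨ ∑-cong xss (λ {ps} _ →
             trans (ℤP.*-distribˡ-+ (δ (length ps) m) (when (1 ≤? j) (signedBinomial (blocks ps) (j ∸ 1)))
                                                        (ℤ.- signedBinomial (blocks ps) j))
                   (cong₂ ℤ._+_ (sym (when-*ˡ (1 ≤? j) (δ (length ps) m) (signedBinomial (blocks ps) (j ∸ 1))))
                                (sym (ℤP.neg-distribʳ-* (δ (length ps) m) (signedBinomial (blocks ps) j))))) ⟩
      ∑ (λ ps → when (1 ≤? j) (weight m (j ∸ 1) ps) ℤ.- weight m j ps) xss
        ≡⟨ ∑-difference (λ ps → when (1 ≤? j) (weight m (j ∸ 1) ps)) (weight m j) xss ⟩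
      ∑ (λ ps → when (1 ≤? j) (weight m (j ∸ 1) ps)) xss ℤ.- ∑ (weight m j) xss
        ≡⟨ cong (ℤ._- ∑ (weight m j) xss) (∑-when (1 ≤? j) (weight m (j ∸ 1)) xss) ⟩
      when (1 ≤? j) (∑ (weight m (j ∸ 1)) xss) ℤ.- ∑ (weight m j) xss ∎
      where open ≡-Reasoning

    ∑-weight-block-insertions : ∀ m n j
      → ∑ (weight (suc m) j) (concatMap (insertions (block (suc n ∸ k))) (enumerate n (suc n ∸ k)))
        ≡ + suc m ℤ.* (when (1 ≤? j) (D m (suc n ∸ k) (j ∸ 1)) ℤ.- D m (suc n ∸ k) j)
    ∑-weight-block-insertions m n j = begin
      ∑ (weight (suc m) j) (concatMap (insertions (block c)) (enumerate n c))
        ≡⟨ ∑-concatMap-insertions m j (block c) (enumerate n c) ⟩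
      + suc m ℤ.* ∑ (λ ps → δ (length ps) m ℤ.* signedBinomial (blocks (block c ∷ ps)) j) (enumerate n c)
        ≡⟨ cong (+ suc m ℤ.*_) (∑-weight-block m j c (enumerate n c)) ⟩
      + suc m ℤ.* (when (1 ≤? j) (∑ (weight m (j ∸ 1)) (enumerate n c)) ℤ.- ∑ (weight m j) (enumerate n c))
        ≡⟨ cong (λ xss → + suc m ℤ.* (when (1 ≤? j) (∑ (weight m (j ∸ 1)) xss) ℤ.- ∑ (weight m j) xss))
                (enumerate-fuel n c c (suc-∸-k≤ n) ℕP.≤-refl) ⟩
      + suc m ℤ.* (when (1 ≤? j) (D m c (j ∸ 1)) ℤ.- D m c j) ∎
      where
      open ≡-Reasoning
      c : ℕ
      c = suc n ∸ k

    -- A list of m + 1 pieces is a list of m pieces with the piece holding the top value inserted at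
    -- one of m + 1 positions.
    D-suc : ∀ m → D (suc m) ≈ₛ + suc m ·ₛ mulCluster k (D m)
    D-suc m zero    j = sym (ℤP.*-zeroʳ (+ suc m))
    D-suc m (suc n) j = begin
      ∑ (weight (suc m) j) (singles ++ onlyIf d blocksL)
        ≡⟨ ∑-++ (weight (suc m) j) singles _ ⟩
      ∑ (weight (suc m) j) singles ℤ.+ ∑ (weight (suc m) j) (onlyIf d blocksL)
        ≡⟨ cong₂ ℤ._+_ (∑-concatMap-insertions m j (single (suc n)) (enumerate n n))
                       (trans (∑-onlyIf d (weight (suc m) j) blocksL) (cong (when d) (∑-weight-block-insertions m n j))) ⟩
      + suc m ℤ.* D m n j ℤ.+ when d (+ suc m ℤ.* E)
        ≡⟨ cong (ℤ._+_ (+ suc m ℤ.* D m n j)) (when-*ˡ d (+ suc m) E) ⟩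
      + suc m ℤ.* D m n j ℤ.+ + suc m ℤ.* when d E
        ≡⟨ ℤP.*-distribˡ-+ (+ suc m) (D m n j) (when d E) ⟨
      + suc m ℤ.* (D m n j ℤ.+ when d E)
        ≡⟨ cong (λ s → + suc m ℤ.* (D m n j ℤ.+ s)) (when-difference d (when (1 ≤? j) (D m c (j ∸ 1))) (D m c j)) ⟨
      + suc m ℤ.* mulCluster k (D m) (suc n) j ∎
      where
      open ≡-Reasoning
      c : ℕ
      c = suc n ∸ k
      d : Dec (k ≤ suc n)
      d = k ≤? suc n
      singles blocksL : List (List Piece)
      singles = concatMap (insertions (single (suc n))) (enumerate n n)
      blocksL = concatMap (insertions (block c)) (enumerate n c)
      E : ℤ
      E = when (1 ≤? j) (D m c (j ∸ 1)) ℤ.- D m c j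

    D-zero : D 0 ≈ₛ constₛ (+ 1)
    D-zero zero    j = trans (cong (λ x → + 1 ℤ.* x ℤ.+ + 0) (δ-sym 0 j)) (normalise (δ j 0))
      where normalise : ∀ x → + 1 ℤ.* x ℤ.+ + 0 ≡ + 1 ℤ.* x ℤ.* + 1
            normalise = solve-∀
    D-zero (suc n) j = ∑-zero (enumerate (suc n) (suc n)) nonempty
      where
      nonempty : ∀ {ps} → ps ∈ enumerate (suc n) (suc n) → weight 0 j ps ≡ + 0
      nonempty {[]}    ps∈ with () ← proj₁ (IsPerm-enumerate (suc n) (suc n) ps∈)
      nonempty {_ ∷ _} _   = refl

    factorial-·ₛ-cluster^ₛ≈D : ∀ m → + (m !) ·ₛ cluster k ^ₛ m ≈ₛ D m
    factorial-·ₛ-cluster^ₛ≈D = factorial-·ₛ-cluster^ₛ k D D-zero D-suc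

    module _ (non-self-overlapping : ¬ SelfOverlapping τ) where

      no-occurrence-inside-block : ∀ {Z c q} → Unique Z → All (1 ≤_) Z → take k Z ≡ values (block c)
        → 1 ≤ q → q < k → hz τ (take k (drop q Z)) ≡ false
      no-occurrence-inside-block {Z} {c} {q} u-Z pos-Z prefix 1≤q q<k with hz τ (take k (drop q Z)) in occurs
      ... | false = refl
      ... | true with occurrence⇒block (AllP.take⁺ k (AllP.drop⁺ q pos-Z)) occurs
      ...   | c′ , W≡ = ⊥-elim (non-self-overlapping (overlap⇒SelfOverlapping length-X 1≤q q<k u-XW X++Y≡))
        where
        X : List ℕ
        X = take q Z
        k≤Z : k ≤ length Z
        k≤Z = ℕP.m⊓n≡m⇒m≤n (trans (sym (LP.length-take k Z)) (trans (cong length prefix) (length-values c)))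
        length-X : length X ≡ q
        length-X = trans (LP.length-take q Z) (ℕP.m≤n⇒m⊓n≡m (ℕP.≤-trans (ℕP.<⇒≤ q<k) k≤Z))
        u-XW : Unique (X ++ values (block c′))
        u-XW = subst (λ W → Unique (X ++ W)) W≡ (subst Unique (take-+ q k Z) (UniqueP.take⁺ (q ℕ.+ k) u-Z))
        X++Y≡ : X ++ take (k ∸ q) (values (block c′)) ≡ values (block c)
        X++Y≡ = begin
          X ++ take (k ∸ q) (values (block c′)) ≡⟨ cong (λ W → X ++ take (k ∸ q) W) W≡ ⟨
          X ++ take (k ∸ q) (take k (drop q Z)) ≡⟨ cong (X ++_) (LP.take-take (k ∸ q) k (drop q Z)) ⟩
          X ++ take ((k ∸ q) ℕ.⊓ k) (drop q Z)  ≡⟨ cong (λ n → X ++ take n (drop q Z)) (ℕP.m≤n⇒m⊓n≡m (ℕP.m∸n≤m k q)) ⟩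
          X ++ take (k ∸ q) (drop q Z)          ≡⟨ take-+ q (k ∸ q) Z ⟨
          take (q ℕ.+ (k ∸ q)) Z                ≡⟨ cong (λ n → take n Z) (ℕP.m+[n∸m]≡n (ℕP.<⇒≤ q<k)) ⟩
          take k Z                              ≡⟨ prefix ⟩
          values (block c)                      ∎
          where open ≡-Reasoning

      occ-after-block : ∀ {b π c} → Unique (b ∷ π) → All (1 ≤_) (b ∷ π) → take k (b ∷ π) ≡ values (block c)
        → occ τ π ≡ occ τ (drop k (b ∷ π))
      occ-after-block {π = π} u pos prefix =
        occ-drop τ (length as) π λ p<|as| → no-occurrence-inside-block u pos prefix (s≤s z≤n) (s≤s p<|as|)

      -- Non-overlap makes the marked occurrences of π an arbitrary subset of all occurrences, so the
      -- sum below is the coefficient of u^j in (1 + (u - 1))^occ.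
      ∑-segmentations : ∀ f π j → length π < f → Unique π → All (1 ≤_) π
        → ∑ (λ ps → signedBinomial (blocks ps) j) (segmentations f π) ≡ δ (occ τ π) j
      ∑-segmentations (suc f) []      j _        _         _   = ℤP.+-identityʳ (δ 0 j)
      ∑-segmentations (suc f) (b ∷ π) j (s≤s lt) u@(_ ∷ u-π) pos@(_ ∷ pos-π) = begin
        ∑ S (map (single b ∷_) (segmentations f π) ++ onlyIf (blockAt? b π) blockSegs)
          ≡⟨ ∑-++ S (map (single b ∷_) (segmentations f π)) _ ⟩
        ∑ S (map (single b ∷_) (segmentations f π)) ℤ.+ ∑ S (onlyIf (blockAt? b π) blockSegs)
          ≡⟨ cong₂ ℤ._+_ (trans (∑-map S (single b ∷_) (segmentations f π)) (∑-segmentations f π j lt u-π pos-π))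
                         (∑-onlyIf (blockAt? b π) S blockSegs) ⟩
        δ (occ τ π) j ℤ.+ when (blockAt? b π) (∑ S blockSegs)
          ≡⟨ first-block (blockAt? b π) ⟩
        δ (occ τ (b ∷ π)) j ∎
        where
        open ≡-Reasoning
        S : List Piece → ℤ
        S ps = signedBinomial (blocks ps) j
        rest : List ℕ
        rest = drop k (b ∷ π)
        blockSegs : List (List Piece)
        blockSegs = map (block (b ∸ a) ∷_) (segmentations f rest)
        rest<f : length rest < f
        rest<f = ℕP.≤-<-trans (subst (_≤ length π) (sym (LP.length-drop (length as) π)) (ℕP.m∸n≤m (length π) (length as))) lt
        first-block : (d : Dec (take k (b ∷ π) ≡ values (block (b ∸ a))))
          → δ (occ τ π) j ℤ.+ when d (∑ S blockSegs) ≡ δ (occ τ (b ∷ π)) j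
        first-block (no not-block) = trans (ℤP.+-identityʳ _) (cong (λ o → δ o j) (sym (occ-∷-¬block pos not-block)))
        first-block (yes starts-block) = begin
          δ o j ℤ.+ ∑ S blockSegs
            ≡⟨ cong (ℤ._+_ (δ o j)) (trans (∑-map S (block (b ∸ a) ∷_) (segmentations f rest))
                                             (∑-signedBinomial-suc blocks j (segmentations f rest))) ⟩
          δ o j ℤ.+ (when (1 ≤? j) (∑ (λ ps → signedBinomial (blocks ps) (j ∸ 1)) (segmentations f rest))
                     ℤ.- ∑ S (segmentations f rest))
            ≡⟨ cong₂ (λ s t → δ o j ℤ.+ (when (1 ≤? j) s ℤ.- t)) (∑-rest (j ∸ 1)) (∑-rest j) ⟩
          δ o j ℤ.+ (when (1 ≤? j) (δ o (j ∸ 1)) ℤ.- δ o j)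
            ≡⟨ δ-step o j ⟩
          δ (suc o) j
            ≡⟨ cong (λ o′ → δ o′ j) (occ-∷-block starts-block) ⟨
          δ (occ τ (b ∷ π)) j ∎
          where
          o : ℕ
          o = occ τ π
          ∑-rest : ∀ j → ∑ (λ ps → signedBinomial (blocks ps) j) (segmentations f rest) ≡ δ o j
          ∑-rest j = trans (∑-segmentations f rest j rest<f (UniqueP.drop⁺ k u) (AllP.drop⁺ k pos))
                           (cong (λ o′ → δ o′ j) (sym (occ-after-block u pos starts-block)))

      ∑-enumerate : ∀ n j → ∑ (λ ps → signedBinomial (blocks ps) j) (enumerate n n) ≡ occGF τ n j
      ∑-enumerate n j = begin
        ∑ S (enumerate n n)
          ≡⟨ ∑-same-members S (Unique-enumerate n n) u-segmentations to-segmentation from-segmentation ⟩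
        ∑ S (concatMap (segmentations (suc n)) (perms n))
          ≡⟨ ∑-concatMap S (segmentations (suc n)) (perms n) ⟩
        ∑ (λ π → ∑ S (segmentations (suc n) π)) (perms n)
          ≡⟨ ∑-cong (perms n) (λ {π} π∈ → let (length≡ , bounds , u-π) = ∈-perms⁻ π∈ in
               ∑-segmentations (suc n) π j (s≤s (ℕP.≤-reflexive length≡)) u-π (All.map proj₁ bounds)) ⟩
        ∑ (λ π → δ (occ τ π) j) (perms n)
          ≡⟨ length-filter-≟ (occ τ) j (perms n) ⟨
        occGF τ n j ∎
        where
        open ≡-Reasoning
        S : List Piece → ℤ
        S ps = signedBinomial (blocks ps) j
        u-segmentations : Unique (concatMap (segmentations (suc n)) (perms n))
        u-segmentations = Unique-concatMap (segmentations (suc n)) (Unique-perms n)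
          (λ {π} _ → Unique-segmentations (suc n) π)
          λ _ _ ps∈ ps∈′ → trans (sym (flatten-segmentations (suc n) _ ps∈)) (flatten-segmentations (suc n) _ ps∈′)
        to-segmentation : ∀ {ps} → ps ∈ enumerate n n → ps ∈ concatMap (segmentations (suc n)) (perms n)
        to-segmentation {ps} ps∈ = ∈-concatMap-intro (segmentations (suc n)) (∈-perms⁺ perm)
          (∈-segmentations (suc n) ps (s≤s (ℕP.≤-reflexive (proj₁ perm))))
          where perm = IsPerm-enumerate n n ps∈
        from-segmentation : ∀ {ps} → ps ∈ concatMap (segmentations (suc n)) (perms n) → ps ∈ enumerate n n
        from-segmentation ps∈ with find (∈-concatMap⁻ (segmentations (suc n)) {xs = perms n} ps∈)
        ... | π , π∈ , ps∈segs = ∈-enumerate n n ℕP.≤-refl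
                                   (subst (IsPerm n) (sym (flatten-segmentations (suc n) π ps∈segs)) (∈-perms⁻ π∈))

      cluster-expansion : ∀ n j M → n < M → sumBelow M (λ m → (+ (m !) ·ₛ cluster k ^ₛ m) n j) ≡ occGF τ n j
      cluster-expansion n j M n<M = begin
        sumBelow M (λ m → (+ (m !) ·ₛ cluster k ^ₛ m) n j)
          ≡⟨ sumBelow-cong M (λ m → factorial-·ₛ-cluster^ₛ≈D m n j) ⟩
        sumBelow M (λ m → ∑ (weight m j) (enumerate n n))
          ≡⟨ sumBelow-∑ M (λ m → weight m j) (enumerate n n) ⟩
        ∑ (λ ps → sumBelow M (λ m → weight m j ps)) (enumerate n n)
          ≡⟨ ∑-cong (enumerate n n) (λ {ps} ps∈ → sumBelow-δ M (length ps) _ (ℕP.≤-<-trans (length≤n ps∈) n<M)) ⟩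
        ∑ (λ ps → signedBinomial (blocks ps) j) (enumerate n n)
          ≡⟨ ∑-enumerate n j ⟩
        occGF τ n j ∎
        where
        open ≡-Reasoning
        length≤n : ∀ {ps} → ps ∈ enumerate n n → length ps ≤ n
        length≤n {ps} ps∈ = subst (length ps ≤_) (proj₁ (IsPerm-enumerate n n ps∈)) (length≤length-flatten ps)

corollary1 : (τ : List ℕ) → IsPerm (length τ) τ → 1 ≤ length τ → ¬ SelfOverlapping τ
    → HasSum (λ m → (+ (m !)) ·ₛ (xₛ +ₛ (uₛ -ₛ constₛ (+ 1)) *ₛ xₛ ^ₛ length τ) ^ₛ m) (occGF τ)
corollary1 []       _      ()  _
corollary1 (a ∷ as) τ-perm _   non-self-overlapping n j =
  suc n , λ M n<M → Pattern.WellFormed.cluster-expansion a as τ-perm non-self-overlapping n j M n<M
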